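{- Let $m\ge1$, $k\ge m$ and $h$ be integers. The generating function $\sum_{n\ge0}d(n)q^n$, where $d(n)$ is the number of partitions $\lambda$ of $n$ into distinct parts with an $h$-fixed hook in the $m$th column arising from a part of size $k$ (i.e. there is a row $s$ with $\lambda_s=k$ and $h_{s,m}(\lambda)=s+h$), is \[ \sum_{s=0}^{k-m}\frac{q^{s(k+m)+k(k-h-m+1)+\binom{s+k-m+1-h}{2}+\binom{s}{2}}\,(-q;q)_{m-1}}{(q;q)_{s+k-h-m}}\binom{k-m}{s}_q . \]
   Context: For a partition $\lambda$ with conjugate $\lambda'$, $h_{i,j}(\lambda)=\lambda_i+\lambda'_j-i-j+1$ is the hook length of cell $(i,j)$, $j\le\lambda_i$. Notation: $(a;b)_n=\prod_{t=0}^{n-1}(1-ab^t)$; $\binom{a}{b}_q=\frac{(q;q)_a}{(q;q)_b(q;q)_{a-b}}$ is the Gaussian binomial coefficient; $\binom{x}{2}=x(x-1)/2$ is the ordinary binomial coefficient; conventionally $1/(q;q)_j=0$ for $j<0$. -}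

module Defs where

open import Data.Nat as ℕ using (ℕ; zero; suc; _∸_; _≤_)
open import Data.Integer as ℤ using (ℤ; +_; -[1+_]; _+_; _*_; _-_; -_)
open import Data.Fin using (Fin; toℕ)
open import Data.List using (List; []; _∷_; length; lookup; filter)
open import Data.Nat.ListAction using (sum)
open import Data.Vec as Vec using (Vec; _∷ʳ_)
open import Data.Product using (Σ; _×_; ∃; _,_)
open import Relation.Binary.PropositionalEquality using (_≡_)
open import Relation.Nullary.Decidable using (Dec)
open import Data.Nat.Properties using (_≤?_)

-- Distinct-part partitions, represented as lists λ₁ > λ₂ > … > λℓ > 0

data StrictDec : List ℕ → Set where
  []  : StrictDec []
  [_] : ∀ {a} → StrictDec (a ∷ [])
  _∷_ : ∀ {a b l} → ℕ.suc b ≤ a → StrictDec (b ∷ l) → StrictDec (a ∷ b ∷ l)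

data AllPos : List ℕ → Set where
  []  : AllPos []
  _∷_ : ∀ {a l} → 1 ≤ a → AllPos l → AllPos (a ∷ l)

DistinctPartition : ℕ → List ℕ → Set
DistinctPartition n λ' = StrictDec λ' × AllPos λ' × sum λ' ≡ n

conj : List ℕ → ℕ → ℕ
conj λ' j = length (filter (λ a → j ≤? a) λ')

-- hook length h_{i,j}(λ) = λ_i + λ'_j - i - j + 1 (as an integer), i,j 1-indexed
hook : List ℕ → ℕ → ℕ → ℕ → ℤ
hook λ' λi i j = + λi + + conj λ' j - + i - + j + + 1

-- λ has an h-fixed hook in the m-th column arising from a part of size k:
-- there is a row s (1-indexed) with λ_s = k and h_{s,m}(λ) = s + h.
-- (k ≥ m in the theorem, so the cell (s,m) lies in λ.)
HasFixedHook : ℕ → ℕ → ℤ → List ℕ → Set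
HasFixedHook m k h λ' =
  Σ (Fin (length λ')) λ i →
    (lookup λ' i ≡ k) ×
    (hook λ' (lookup λ' i) (suc (toℕ i)) m ≡ + suc (toℕ i) + h)

Qualifies : ℕ → ℕ → ℤ → ℕ → List ℕ → Set
Qualifies m k h n λ' = DistinctPartition n λ' × HasFixedHook m k h λ'

-- Formal power series over ℤ: coefficient functions ℕ → ℤ

PS : Set
PS = ℕ → ℤ

Σ< : ℕ → (ℕ → ℤ) → ℤ
Σ< zero    f = + 0
Σ< (suc n) f = Σ< n f + f n

oneS : PS
oneS zero    = + 1
oneS (suc _) = + 0

zeroS : PS
zeroS _ = + 0

_⊛_ : PS → PS → PS
(f ⊛ g) n = Σ< (suc n) (λ i → f i * g (n ∸ i))

infixl 7 _⊛_

mono : ℤ → ℕ → PS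
mono c e n with e ℕ.≟ n
... | Relation.Nullary.Decidable.yes _ = c
... | Relation.Nullary.Decidable.no  _ = + 0

onePlus : ℤ → ℕ → PS
onePlus c e n = oneS n + mono c e n

Π< : ℕ → (ℕ → PS) → PS
Π< zero    F = oneS
Π< (suc n) F = Π< n F ⊛ F n

qPoch : ℕ → PS
qPoch n = Π< n (λ t → onePlus (- + 1) (suc t))

-- (-q;q)_n = ∏_{t<n} (1 - (-q) q^t) = ∏_{t<n} (1 + q^{t+1})
negqPoch : ℕ → PS
negqPoch n = Π< n (λ t → onePlus (+ 1) (suc t))

ΣF : (n : ℕ) → (Fin n → ℤ) → ℤ
ΣF zero    f = + 0
ΣF (suc n) f = f Data.Fin.zero + ΣF n (λ j → f (Data.Fin.suc j))

-- multiplicative inverse 1/a of a series a with a 0 = 1: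
-- b 0 = 1, b (n+1) = - Σ_{j=0}^{n} a (n+1-j) b j
invVec : PS → (n : ℕ) → Vec ℤ (suc n)
invVec a zero    = + 1 Vec.∷ Vec.[]
invVec a (suc n) =
  let v = invVec a n in
  v ∷ʳ (- ΣF (suc n) (λ j → a (suc n ∸ toℕ j) * Vec.lookup v j))

inv : PS → PS
inv a n = Vec.last (invVec a n)

-- 1/(q;q)_j for integer j, with the convention 1/(q;q)_j = 0 for j < 0
invQPoch : ℤ → PS
invQPoch (+ j)    = inv (qPoch j)
invQPoch -[1+ _ ] = zeroS

-- Gaussian binomial [a choose b]_q = (q;q)_a / ((q;q)_b (q;q)_{a-b}), b ≤ a
gauss : ℕ → ℕ → PS
gauss a b = qPoch a ⊛ inv (qPoch b) ⊛ inv (qPoch (a ∸ b))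

tri : ℕ → ℕ
tri zero    = zero
tri (suc n) = n ℕ.+ tri n          -- tri n = n(n-1)/2

binom2 : ℤ → ℤ
binom2 (+ n)    = + tri n
binom2 -[1+ n ] = + tri (suc (suc n))   -- x = -(n+1): x(x-1)/2 = (n+1)(n+2)/2

-- q^e · F for an integer exponent e (coefficients at negative indices of F are 0)
shiftZ : ℤ → PS → PS
shiftZ e F n with + n - e
... | + j      = F j
... | -[1+ _ ] = + 0

rhsTerm : ℕ → ℕ → ℤ → ℕ → PS
rhsTerm m k h s =
  shiftZ (+ s * (+ k + + m) + + k * (+ k - h - + m + + 1)
          + binom2 (+ s + + k - + m + + 1 - h) + binom2 (+ s))
         (invQPoch (+ s + + k - h - + m) ⊛ negqPoch (m ∸ 1) ⊛ gauss (k ∸ m) s)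

rhs : ℕ → ℕ → ℤ → PS
rhs m k h n = Σ< (suc (k ∸ m)) (λ s → rhsTerm m k h s n)

-- A distinct-part partition with λ_s = k splits as λ = A ++ k ∷ B ++ C, where the parts of A
-- exceed k, those of B lie in [m, k) and those of C lie below m.  Since λ'_m = s + |B|, the hook
-- h_{s,m} equals s + h exactly when |A| = s - 1 = |B| + k - m - h.  So for |B| = t the partitions
-- are triples of independent choices, and the generating function factors: A contributes
-- q^(k a + C(a+1,2)) / (q;q)_a with a = t + k - m - h, B contributes q^(t m + C(t,2)) [k-m choose t]_q,
-- C contributes (-q;q)_(m-1), and the part k contributes q^k.
-- The count is computed by listing the triples explicitly, graded by weight, so that list lengths
-- multiply like coefficients of power series.  The parts above k are listed in a finite window,
-- whose Gaussian polynomial agrees with 1/(q;q)_a in every degree that matters.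

module Submission where

open import Defs
open import Algebra.Bundles using (CommutativeSemigroup)
import Algebra.Properties.CommutativeSemigroup as CommutativeSemigroupProperties
open import Data.Empty using (⊥; ⊥-elim)
open import Data.Fin as Fin using (Fin; toℕ)
open import Data.Integer as ℤ using (ℤ; +_; -[1+_]; _+_; _*_; -_; _-_; 1ℤ; -1ℤ)
import Data.Integer.Properties as ℤₚ
open import Data.Integer.Tactic.RingSolver using (solve-∀)
open import Data.List using (List; []; _∷_; _++_; length; map; lookup; filter; cartesianProduct)
import Data.List.Properties as Listₚ
open import Data.List.Membership.Propositional using (_∈_)
open import Data.List.Membership.Propositional.Properties
  using (∈-++⁺ˡ; ∈-++⁺ʳ; ∈-++⁻; ∈-map⁺; ∈-map⁻; ∈-cartesianProduct⁺; ∈-cartesianProduct⁻)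
open import Data.List.Membership.Propositional.Properties.WithK using (unique∧set⇒bag)
open import Data.List.Relation.Binary.BagAndSetEquality using (_∼[_]_; set; ∼bag⇒↭)
open import Data.List.Relation.Binary.Disjoint.Propositional using (Disjoint)
open import Data.List.Relation.Binary.Permutation.Propositional.Properties using (↭-length)
open import Data.List.Relation.Unary.All as All using (All; []; _∷_)
import Data.List.Relation.Unary.All.Properties as Allₚ
open import Data.List.Relation.Unary.AllPairs using (AllPairs; []; _∷_)
import Data.List.Relation.Unary.AllPairs.Properties as AllPairsₚ
open import Data.List.Relation.Unary.Any using (here; there)
open import Data.List.Relation.Unary.Unique.Propositional using (Unique)
import Data.List.Relation.Unary.Unique.Propositional.Properties as Uniqueₚ
open import Data.Nat as ℕ using (ℕ; zero; suc; _∸_; _<_; _≤_; _>_; _≤?_; s≤s; z≤n)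
open import Data.Nat.ListAction using (sum)
open import Data.Nat.ListAction.Properties using (sum-++)
import Data.Nat.Properties as ℕₚ
import Data.Nat.Tactic.RingSolver as ℕ-Ring
open import Data.Product using (Σ; _×_; _,_; ∃-syntax; proj₁; proj₂; map₁)
open import Data.Sum using (_⊎_; inj₁; inj₂)
open import Data.Unit using (⊤; tt)
open import Data.Vec as Vec using (Vec; _∷ʳ_)
import Data.Vec.Properties as Vecₚ
open import Function using (_∘_; _∘′_)
open import Function.Bundles using (_⇔_; mk⇔; Equivalence)
open import Function.Construct.Composition using (_⇔-∘_)
open import Function.Construct.Symmetry using (⇔-sym)
open import Relation.Binary.Bundles using (Setoid)
open import Relation.Binary.PropositionalEquality
import Relation.Binary.Reasoning.Setoid as SetoidReasoning
open import Relation.Nullary using (yes; no; contradiction)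

private
  variable
    X Y : Set

-- Formal power series

module ≗-Reasoning = SetoidReasoning (ℕ →-setoid ℤ)

Σ<-cong-< : ∀ n {f g : ℕ → ℤ} → (∀ {i} → i < n → f i ≡ g i) → Σ< n f ≡ Σ< n g
Σ<-cong-< zero    f≡g = refl
Σ<-cong-< (suc n) f≡g = cong₂ _+_ (Σ<-cong-< n (f≡g ∘ ℕₚ.m<n⇒m<1+n)) (f≡g (ℕₚ.n<1+n n))

Σ<-cong : ∀ n {f g : ℕ → ℤ} → f ≗ g → Σ< n f ≡ Σ< n g
Σ<-cong n f≗g = Σ<-cong-< n (λ {i} _ → f≗g i)

Σ<-zero : ∀ n {f : ℕ → ℤ} → (∀ {i} → i < n → f i ≡ + 0) → Σ< n f ≡ + 0
Σ<-zero n f≡0 = trans (Σ<-cong-< n f≡0) (zeros n)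
  where
  zeros : ∀ n → Σ< n (λ _ → + 0) ≡ + 0
  zeros zero    = refl
  zeros (suc n) = cong (_+ + 0) (zeros n)

Σ<-+ : ∀ n (f g : ℕ → ℤ) → Σ< n (λ i → f i + g i) ≡ Σ< n f + Σ< n g
Σ<-+ zero    f g = refl
Σ<-+ (suc n) f g = trans (cong (_+ (f n + g n)) (Σ<-+ n f g)) (interchange (Σ< n f) (Σ< n g) (f n) (g n))
  where
  interchange : ∀ a b c d → a + b + (c + d) ≡ a + c + (b + d)
  interchange = solve-∀

*-Σ< : ∀ n c (f : ℕ → ℤ) → c * Σ< n f ≡ Σ< n (λ i → c * f i)
*-Σ< zero    c f = ℤₚ.*-zeroʳ c
*-Σ< (suc n) c f = trans (ℤₚ.*-distribˡ-+ c (Σ< n f) (f n)) (cong (_+ c * f n) (*-Σ< n c f))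

Σ<-* : ∀ n c (f : ℕ → ℤ) → Σ< n f * c ≡ Σ< n (λ i → f i * c)
Σ<-* n c f = trans (ℤₚ.*-comm (Σ< n f) c) (trans (*-Σ< n c f) (Σ<-cong n (λ i → ℤₚ.*-comm c (f i))))

Σ<-head : ∀ n (f : ℕ → ℤ) → Σ< (suc n) f ≡ f 0 + Σ< n (f ∘ suc)
Σ<-head zero    f = trans (ℤₚ.+-identityˡ (f 0)) (sym (ℤₚ.+-identityʳ (f 0)))
Σ<-head (suc n) f = trans (cong (_+ f (suc n)) (Σ<-head n f)) (ℤₚ.+-assoc (f 0) _ _)

Σ<-reverse : ∀ n (f : ℕ → ℤ) → Σ< (suc n) f ≡ Σ< (suc n) (λ i → f (n ∸ i))
Σ<-reverse zero    f = refl
Σ<-reverse (suc n) f = begin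
  Σ< (suc n) f + f (suc n)                  ≡⟨ ℤₚ.+-comm (Σ< (suc n) f) (f (suc n)) ⟩
  f (suc n) + Σ< (suc n) f                  ≡⟨ cong (λ x → f (suc n) + x) (Σ<-reverse n f) ⟩
  f (suc n) + Σ< (suc n) (λ i → f (n ∸ i))  ≡⟨ Σ<-head (suc n) (λ i → f (suc n ∸ i)) ⟨
  Σ< (suc (suc n)) (λ i → f (suc n ∸ i))    ∎
  where open ≡-Reasoning

Σ<-triangle : ∀ n (F : ℕ → ℕ → ℤ) →
  Σ< (suc n) (λ p → Σ< (suc p) (λ i → F i p)) ≡ Σ< (suc n) (λ i → Σ< (suc (n ∸ i)) (λ j → F i (i ℕ.+ j)))
Σ<-triangle zero    F = refl
Σ<-triangle (suc n) F = begin
  Σ< (suc n) (λ p → Σ< (suc p) (λ i → F i p)) + (Σ< (suc n) (λ i → F i (suc n)) + F (suc n) (suc n))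
    ≡⟨ cong (_+ (Σ< (suc n) (λ i → F i (suc n)) + F (suc n) (suc n))) (Σ<-triangle n F) ⟩
  Σ< (suc n) rows + (Σ< (suc n) (λ i → F i (suc n)) + F (suc n) (suc n))
    ≡⟨ ℤₚ.+-assoc (Σ< (suc n) rows) _ _ ⟨
  Σ< (suc n) rows + Σ< (suc n) (λ i → F i (suc n)) + F (suc n) (suc n)
    ≡⟨ cong (_+ F (suc n) (suc n)) (Σ<-+ (suc n) rows (λ i → F i (suc n))) ⟨
  Σ< (suc n) (λ i → rows i + F i (suc n)) + F (suc n) (suc n)
    ≡⟨ cong₂ _+_ (Σ<-cong-< (suc n) extendRow) (sym lastRow) ⟩
  Σ< (suc (suc n)) (λ i → Σ< (suc (suc n ∸ i)) (λ j → F i (i ℕ.+ j))) ∎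
  where
  open ≡-Reasoning
  rows : ℕ → ℤ
  rows i = Σ< (suc (n ∸ i)) (λ j → F i (i ℕ.+ j))
  extendRow : ∀ {i} → i < suc n → rows i + F i (suc n) ≡ Σ< (suc (suc n ∸ i)) (λ j → F i (i ℕ.+ j))
  extendRow {i} (s≤s i≤n) rewrite ℕₚ.+-∸-assoc 1 i≤n =
    cong (λ p → rows i + F i p) (sym (trans (cong (i ℕ.+_) (sym (ℕₚ.+-∸-assoc 1 i≤n))) (ℕₚ.m+[n∸m]≡n (ℕₚ.m≤n⇒m≤1+n i≤n))))
  lastRow : Σ< (suc (suc n ∸ suc n)) (λ j → F (suc n) (suc n ℕ.+ j)) ≡ F (suc n) (suc n)
  lastRow rewrite ℕₚ.n∸n≡0 n | ℕₚ.+-identityʳ n = ℤₚ.+-identityˡ _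

infixl 6 _⊕_
infixr 8 _·_

_⊕_ : PS → PS → PS
(f ⊕ g) n = f n + g n

_·_ : ℤ → PS → PS
(c · f) n = c * f n

⊛-cong : ∀ {f f′ g g′} → f ≗ f′ → g ≗ g′ → f ⊛ g ≗ f′ ⊛ g′
⊛-cong f≗f′ g≗g′ n = Σ<-cong (suc n) (λ i → cong₂ _*_ (f≗f′ i) (g≗g′ (n ∸ i)))

⊛-congˡ : ∀ f {g g′} → g ≗ g′ → f ⊛ g ≗ f ⊛ g′
⊛-congˡ f = ⊛-cong {f = f} (λ _ → refl)

⊛-congʳ : ∀ g {f f′} → f ≗ f′ → f ⊛ g ≗ f′ ⊛ g
⊛-congʳ g f≗f′ = ⊛-cong {g = g} f≗f′ (λ _ → refl)

⊛-comm : ∀ f g → f ⊛ g ≗ g ⊛ f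
⊛-comm f g n = trans (Σ<-reverse n (λ i → f i * g (n ∸ i))) (Σ<-cong-< (suc n) swap)
  where
  swap : ∀ {i} → i < suc n → f (n ∸ i) * g (n ∸ (n ∸ i)) ≡ g i * f (n ∸ i)
  swap {i} (s≤s i≤n) = trans (cong (λ j → f (n ∸ i) * g j) (ℕₚ.m∸[m∸n]≡n i≤n)) (ℤₚ.*-comm (f (n ∸ i)) (g i))

⊛-identityˡ : ∀ f → oneS ⊛ f ≗ f
⊛-identityˡ f n = begin
  Σ< (suc n) (λ i → oneS i * f (n ∸ i))         ≡⟨ Σ<-head n (λ i → oneS i * f (n ∸ i)) ⟩
  + 1 * f n + Σ< n (λ i → + 0 * f (n ∸ suc i))
    ≡⟨ cong₂ _+_ (ℤₚ.*-identityˡ (f n)) (Σ<-zero n (λ {i} _ → ℤₚ.*-zeroˡ (f (n ∸ suc i)))) ⟩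
  f n + + 0                                     ≡⟨ ℤₚ.+-identityʳ (f n) ⟩
  f n                                           ∎
  where open ≡-Reasoning

⊛-identityʳ : ∀ f → f ⊛ oneS ≗ f
⊛-identityʳ f n = trans (⊛-comm f oneS n) (⊛-identityˡ f n)

⊛-zeroˡ : ∀ f → zeroS ⊛ f ≗ zeroS
⊛-zeroˡ f n = Σ<-zero (suc n) (λ {i} _ → ℤₚ.*-zeroˡ (f (n ∸ i)))

⊛-distribˡ-⊕ : ∀ f g h → f ⊛ (g ⊕ h) ≗ f ⊛ g ⊕ f ⊛ h
⊛-distribˡ-⊕ f g h n = trans (Σ<-cong (suc n) (λ i → ℤₚ.*-distribˡ-+ (f i) (g (n ∸ i)) (h (n ∸ i)))) (Σ<-+ (suc n) _ _)

⊛-distribʳ-⊕ : ∀ f g h → (g ⊕ h) ⊛ f ≗ g ⊛ f ⊕ h ⊛ f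
⊛-distribʳ-⊕ f g h n = trans (Σ<-cong (suc n) (λ i → ℤₚ.*-distribʳ-+ (f (n ∸ i)) (g i) (h i))) (Σ<-+ (suc n) _ _)

⊛-·ʳ : ∀ c f g → f ⊛ (c · g) ≗ c · (f ⊛ g)
⊛-·ʳ c f g n = trans (Σ<-cong (suc n) (λ i → x∙cy≡c∙xy (f i) c (g (n ∸ i)))) (sym (*-Σ< (suc n) c _))
  where
  x∙cy≡c∙xy : ∀ x c y → x * (c * y) ≡ c * (x * y)
  x∙cy≡c∙xy = solve-∀

⊛-assoc : ∀ f g h → (f ⊛ g) ⊛ h ≗ f ⊛ (g ⊛ h)
⊛-assoc f g h n = begin
  Σ< (suc n) (λ p → Σ< (suc p) (λ i → f i * g (p ∸ i)) * h (n ∸ p))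
    ≡⟨ Σ<-cong (suc n) (λ p → Σ<-* (suc p) (h (n ∸ p)) (λ i → f i * g (p ∸ i))) ⟩
  Σ< (suc n) (λ p → Σ< (suc p) (λ i → f i * g (p ∸ i) * h (n ∸ p)))
    ≡⟨ Σ<-triangle n (λ i p → f i * g (p ∸ i) * h (n ∸ p)) ⟩
  Σ< (suc n) (λ i → Σ< (suc (n ∸ i)) (λ j → f i * g (i ℕ.+ j ∸ i) * h (n ∸ (i ℕ.+ j))))
    ≡⟨ Σ<-cong (suc n) (λ i → Σ<-cong (suc (n ∸ i)) (λ j → reindex i j)) ⟩
  Σ< (suc n) (λ i → Σ< (suc (n ∸ i)) (λ j → f i * (g j * h (n ∸ i ∸ j))))
    ≡⟨ Σ<-cong (suc n) (λ i → *-Σ< (suc (n ∸ i)) (f i) (λ j → g j * h (n ∸ i ∸ j))) ⟨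
  Σ< (suc n) (λ i → f i * Σ< (suc (n ∸ i)) (λ j → g j * h (n ∸ i ∸ j)))
    ∎
  where
  open ≡-Reasoning
  reindex : ∀ i j → f i * g (i ℕ.+ j ∸ i) * h (n ∸ (i ℕ.+ j)) ≡ f i * (g j * h (n ∸ i ∸ j))
  reindex i j rewrite ℕₚ.m+n∸m≡n i j | ℕₚ.∸-+-assoc n i j = ℤₚ.*-assoc (f i) (g j) _

⊛-commutativeSemigroup : CommutativeSemigroup _ _
⊛-commutativeSemigroup = record
  { Carrier = PS
  ; _≈_ = _≗_
  ; _∙_ = _⊛_
  ; isCommutativeSemigroup = record
    { isSemigroup = record
      { isMagma = record { isEquivalence = Setoid.isEquivalence (ℕ →-setoid ℤ) ; ∙-cong = ⊛-cong }
      ; assoc = ⊛-assoc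
      }
    ; comm = ⊛-comm
    }
  }

shift : ℕ → PS → PS
shift zero    f n       = f n
shift (suc e) f zero    = + 0
shift (suc e) f (suc n) = shift e f n

shift-+ : ∀ e f i → shift e f (e ℕ.+ i) ≡ f i
shift-+ zero    f i = refl
shift-+ (suc e) f i = shift-+ e f i

shift-< : ∀ e f {n} → n < e → shift e f n ≡ + 0
shift-< (suc e) f {zero}  _         = refl
shift-< (suc e) f {suc n} (s≤s n<e) = shift-< e f n<e

shift-≤ : ∀ e f {n} → e ≤ n → shift e f n ≡ f (n ∸ e)
shift-≤ e f {n} e≤n = trans (cong (shift e f) (sym (ℕₚ.m+[n∸m]≡n e≤n))) (shift-+ e f (n ∸ e))

shift-cong : ∀ e {f g} → f ≗ g → shift e f ≗ shift e g
shift-cong zero    f≗g n       = f≗g n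
shift-cong (suc e) f≗g zero    = refl
shift-cong (suc e) f≗g (suc n) = shift-cong e f≗g n

shift-shift : ∀ a b f → shift a (shift b f) ≗ shift (a ℕ.+ b) f
shift-shift zero    b f n       = refl
shift-shift (suc a) b f zero    = refl
shift-shift (suc a) b f (suc n) = shift-shift a b f n

shift-⊕ : ∀ e f g → shift e (f ⊕ g) ≗ shift e f ⊕ shift e g
shift-⊕ zero    f g n       = refl
shift-⊕ (suc e) f g zero    = refl
shift-⊕ (suc e) f g (suc n) = shift-⊕ e f g n

shift-· : ∀ e c f → shift e (c · f) ≗ c · shift e f
shift-· zero    c f n       = refl
shift-· (suc e) c f zero    = sym (ℤₚ.*-zeroʳ c)
shift-· (suc e) c f (suc n) = shift-· e c f n

shift-zeroS : ∀ e → shift e zeroS ≗ zeroS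
shift-zeroS zero    n       = refl
shift-zeroS (suc e) zero    = refl
shift-zeroS (suc e) (suc n) = shift-zeroS e n

⊛-shiftˡ : ∀ e f g → shift e f ⊛ g ≗ shift e (f ⊛ g)
⊛-shiftˡ zero    f g n       = refl
⊛-shiftˡ (suc e) f g zero    = cong (λ x → + 0 + x) (ℤₚ.*-zeroˡ (g 0))
⊛-shiftˡ (suc e) f g (suc n) = begin
  Σ< (suc (suc n)) (λ i → shift (suc e) f i * g (suc n ∸ i))   ≡⟨ Σ<-head (suc n) _ ⟩
  + 0 * g (suc n) + (shift e f ⊛ g) n                         ≡⟨ cong₂ _+_ (ℤₚ.*-zeroˡ (g (suc n))) (⊛-shiftˡ e f g n) ⟩
  + 0 + shift e (f ⊛ g) n                                     ≡⟨ ℤₚ.+-identityˡ _ ⟩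
  shift e (f ⊛ g) n                                           ∎
  where open ≡-Reasoning

⊛-shiftʳ : ∀ e f g → f ⊛ shift e g ≗ shift e (f ⊛ g)
⊛-shiftʳ e f g n = begin
  (f ⊛ shift e g) n  ≡⟨ ⊛-comm f (shift e g) n ⟩
  (shift e g ⊛ f) n  ≡⟨ ⊛-shiftˡ e g f n ⟩
  shift e (g ⊛ f) n  ≡⟨ shift-cong e (⊛-comm g f) n ⟩
  shift e (f ⊛ g) n  ∎
  where open ≡-Reasoning

mono≗·shift : ∀ c e → mono c e ≗ c · shift e oneS
mono≗·shift c e n with e ℕ.≟ n
... | yes refl = trans (sym (ℤₚ.*-identityʳ c)) (cong (c *_) (sym (trans (shift-≤ e oneS ℕₚ.≤-refl) (cong oneS (ℕₚ.n∸n≡0 e)))))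
... | no  e≢n  = trans (sym (ℤₚ.*-zeroʳ c)) (cong (c *_) (sym (shifted-oneS-vanishes (ℕₚ.≤-<-connex e n))))
  where
  shifted-oneS-vanishes : e ≤ n ⊎ n < e → shift e oneS n ≡ + 0
  shifted-oneS-vanishes (inj₂ n<e) = shift-< e oneS n<e
  shifted-oneS-vanishes (inj₁ e≤n) with n ∸ e in n∸e≡
  ... | zero  = ⊥-elim (e≢n (ℕₚ.≤-antisym e≤n (ℕₚ.m∸n≡0⇒m≤n n∸e≡)))
  ... | suc _ = trans (shift-≤ e oneS e≤n) (cong oneS n∸e≡)

⊛-onePlus : ∀ c e f → f ⊛ onePlus c e ≗ f ⊕ c · shift e f
⊛-onePlus c e f = begin
  f ⊛ onePlus c e                  ≈⟨ ⊛-congˡ f (λ n → cong (λ x → oneS n + x) (mono≗·shift c e n)) ⟩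
  f ⊛ (oneS ⊕ c · shift e oneS)    ≈⟨ ⊛-distribˡ-⊕ f oneS (c · shift e oneS) ⟩
  f ⊛ oneS ⊕ f ⊛ c · shift e oneS  ≈⟨ (λ n → cong₂ _+_ (⊛-identityʳ f n) (⊛-·ʳ c f (shift e oneS) n)) ⟩
  f ⊕ c · (f ⊛ shift e oneS)       ≈⟨ (λ n → cong (λ x → f n + c * x)
                                              (trans (⊛-shiftʳ e f oneS n) (shift-cong e (⊛-identityʳ f) n))) ⟩
  f ⊕ c · shift e f                ∎
  where open ≗-Reasoning

lookup-∷ʳ : ∀ {n} (v : Vec X n) x (g : ℕ → X) → (∀ j → Vec.lookup v j ≡ g (toℕ j)) → x ≡ g n →
            ∀ j → Vec.lookup (v ∷ʳ x) j ≡ g (toℕ j)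
lookup-∷ʳ Vec.[]       x g v≡g x≡g Fin.zero    = x≡g
lookup-∷ʳ (y Vec.∷ v) x g v≡g x≡g Fin.zero    = v≡g Fin.zero
lookup-∷ʳ (y Vec.∷ v) x g v≡g x≡g (Fin.suc j) = lookup-∷ʳ v x (g ∘ suc) (v≡g ∘ Fin.suc) x≡g j

lookup-invVec : ∀ a n j → Vec.lookup (invVec a n) j ≡ inv a (toℕ j)
lookup-invVec a zero    Fin.zero = refl
lookup-invVec a (suc n) = lookup-∷ʳ (invVec a n) _ (inv a) (lookup-invVec a n) (sym (Vecₚ.last-∷ʳ _ (invVec a n)))

ΣF≡Σ< : ∀ n (f : Fin n → ℤ) (g : ℕ → ℤ) → (∀ j → f j ≡ g (toℕ j)) → ΣF n f ≡ Σ< n g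
ΣF≡Σ< zero    f g f≡g = refl
ΣF≡Σ< (suc n) f g f≡g =
  trans (cong₂ _+_ (f≡g Fin.zero) (ΣF≡Σ< n (f ∘ Fin.suc) (g ∘ suc) (f≡g ∘ Fin.suc))) (sym (Σ<-head n g))

inv-suc : ∀ a n → inv a (suc n) ≡ - Σ< (suc n) (λ i → a (suc n ∸ i) * inv a i)
inv-suc a n = trans (Vecₚ.last-∷ʳ _ (invVec a n))
  (cong -_ (ΣF≡Σ< (suc n) _ _ (λ j → cong (a (suc n ∸ toℕ j) *_) (lookup-invVec a n j))))

inv-⊛ : ∀ a → a 0 ≡ + 1 → inv a ⊛ a ≗ oneS
inv-⊛ a a₀≡1 zero    = cong (λ x → + 0 + + 1 * x) a₀≡1
inv-⊛ a a₀≡1 (suc n) = begin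
  S + inv a (suc n) * a (n ∸ n)
    ≡⟨ cong₂ (λ x y → S + x * a y) (inv-suc a n) (ℕₚ.n∸n≡0 n) ⟩
  S + - Σ< (suc n) (λ i → a (suc n ∸ i) * inv a i) * a 0
    ≡⟨ cong₂ (λ x y → S + - x * y) (Σ<-cong (suc n) (λ i → ℤₚ.*-comm (a (suc n ∸ i)) (inv a i))) a₀≡1 ⟩
  S + - S * + 1
    ≡⟨ x-x≡0 S ⟩
  + 0 ∎
  where
  open ≡-Reasoning
  S = Σ< (suc n) (λ i → inv a i * a (suc n ∸ i))
  x-x≡0 : ∀ x → x + - x * + 1 ≡ + 0
  x-x≡0 = solve-∀

⊛-inverseʳ : ∀ a → a 0 ≡ + 1 → a ⊛ inv a ≗ oneS
⊛-inverseʳ a a₀≡1 n = trans (⊛-comm a (inv a) n) (inv-⊛ a a₀≡1 n)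

x⊛a≗y⇒x≗y⊛inv-a : ∀ {x a y} → a 0 ≡ + 1 → x ⊛ a ≗ y → x ≗ y ⊛ inv a
x⊛a≗y⇒x≗y⊛inv-a {x} {a} {y} a₀≡1 x⊛a≗y = begin
  x                  ≈⟨ ⊛-identityʳ x ⟨
  x ⊛ oneS           ≈⟨ ⊛-congˡ x (⊛-inverseʳ a a₀≡1) ⟨
  x ⊛ (a ⊛ inv a)    ≈⟨ ⊛-assoc x a (inv a) ⟨
  (x ⊛ a) ⊛ inv a    ≈⟨ ⊛-congʳ (inv a) x⊛a≗y ⟩
  y ⊛ inv a          ∎
  where open ≗-Reasoning

Π<-constant-term : ∀ n F → (∀ t → F t 0 ≡ + 1) → Π< n F 0 ≡ + 1
Π<-constant-term zero    F F₀≡1 = refl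
Π<-constant-term (suc n) F F₀≡1 = cong₂ (λ x y → + 0 + x * y) (Π<-constant-term n F F₀≡1) (F₀≡1 n)

qPoch-constant-term : ∀ n → qPoch n 0 ≡ + 1
qPoch-constant-term n = Π<-constant-term n _ (λ _ → refl)

⊛-cancelʳ : ∀ {x y} a → a 0 ≡ + 1 → x ⊛ a ≗ y ⊛ a → x ≗ y
⊛-cancelʳ {x} {y} a a₀≡1 xa≗ya = begin
  x                  ≈⟨ x⊛a≗y⇒x≗y⊛inv-a a₀≡1 xa≗ya ⟩
  (y ⊛ a) ⊛ inv a    ≈⟨ ⊛-assoc y a (inv a) ⟩
  y ⊛ (a ⊛ inv a)    ≈⟨ ⊛-congˡ y (⊛-inverseʳ a a₀≡1) ⟩
  y ⊛ oneS           ≈⟨ ⊛-identityʳ y ⟩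
  y                  ∎
  where open ≗-Reasoning

shiftZ-+ : ∀ e F → shiftZ (+ e) F ≗ shift e F
shiftZ-+ e F n with ℕₚ.≤-<-connex e n
... | inj₁ e≤n rewrite ℤₚ.m-n≡m⊖n n e | ℤₚ.⊖-≥ e≤n = sym (shift-≤ e F e≤n)
... | inj₂ n<e rewrite ℤₚ.m-n≡m⊖n n e | ℤₚ.⊖-< n<e | ℕₚ.+-∸-assoc 1 n<e = sym (shift-< e F n<e)

shiftZ-vanishes : ∀ e {F} → F ≗ zeroS → shiftZ e F ≗ zeroS
shiftZ-vanishes e {F} F≗0 n with + n - e
... | + j      = F≗0 j
... | -[1+ _ ] = refl

-- Agreement below a degree, and Gaussian polynomials

open CommutativeSemigroupProperties ⊛-commutativeSemigroup using (xy∙z≈xz∙y; x∙yz≈xz∙y)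

infix 4 _≈[<_]_

_≈[<_]_ : PS → ℕ → PS → Set
f ≈[< d ] g = ∀ {i} → i < d → f i ≡ g i

≗⇒≈[<] : ∀ {f g} d → f ≗ g → f ≈[< d ] g
≗⇒≈[<] d f≗g {i} _ = f≗g i

≈[<]-trans : ∀ {f g h d} → f ≈[< d ] g → g ≈[< d ] h → f ≈[< d ] h
≈[<]-trans f≈g g≈h i<d = trans (f≈g i<d) (g≈h i<d)

≈[<]-weaken : ∀ {f g d d′} → d′ ≤ d → f ≈[< d ] g → f ≈[< d′ ] g
≈[<]-weaken d′≤d f≈g i<d′ = f≈g (ℕₚ.<-≤-trans i<d′ d′≤d)

⊛-cong-≈[<] : ∀ {f f′ g g′ d} → f ≈[< d ] f′ → g ≈[< d ] g′ → f ⊛ g ≈[< d ] f′ ⊛ g′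
⊛-cong-≈[<] {f} {f′} {g} {g′} f≈f′ g≈g′ {n} n<d = Σ<-cong-< (suc n) coefficient
  where
  coefficient : ∀ {i} → i < suc n → f i * g (n ∸ i) ≡ f′ i * g′ (n ∸ i)
  coefficient {i} (s≤s i≤n) = cong₂ _*_ (f≈f′ (ℕₚ.≤-<-trans i≤n n<d)) (g≈g′ (ℕₚ.≤-<-trans (ℕₚ.m∸n≤m n i) n<d))

shift-≈[<] : ∀ e {f g n} → f ≈[< suc n ] g → shift e f n ≡ shift e g n
shift-≈[<] e {f} {g} {n} f≈g with ℕₚ.≤-<-connex e n
... | inj₁ e≤n = trans (shift-≤ e f e≤n) (trans (f≈g (s≤s (ℕₚ.m∸n≤m n e))) (sym (shift-≤ e g e≤n)))
... | inj₂ n<e = trans (shift-< e f n<e) (sym (shift-< e g n<e))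

onePlus-≈[<]-oneS : ∀ c e → onePlus c e ≈[< e ] oneS
onePlus-≈[<]-oneS c e {i} i<e with e ℕ.≟ i
... | yes refl = ⊥-elim (ℕₚ.<-irrefl refl i<e)
... | no  _    = ℤₚ.+-identityʳ (oneS i)

Π<-≈[<]-oneS : ∀ n F {d} → (∀ t → F t ≈[< d ] oneS) → Π< n F ≈[< d ] oneS
Π<-≈[<]-oneS zero    F F≈1 = λ _ → refl
Π<-≈[<]-oneS (suc n) F F≈1 =
  ≈[<]-trans (⊛-cong-≈[<] (Π<-≈[<]-oneS n F F≈1) (F≈1 n)) (≗⇒≈[<] _ (⊛-identityˡ oneS))

Π<-+ : ∀ a b F → Π< (a ℕ.+ b) F ≗ Π< a F ⊛ Π< b (λ t → F (a ℕ.+ t))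
Π<-+ a zero    F rewrite ℕₚ.+-identityʳ a = λ n → sym (⊛-identityʳ (Π< a F) n)
Π<-+ a (suc b) F rewrite ℕₚ.+-suc a b = begin
  Π< (a ℕ.+ b) F ⊛ F (a ℕ.+ b)                                      ≈⟨ ⊛-congʳ (F (a ℕ.+ b)) (Π<-+ a b F) ⟩
  (Π< a F ⊛ Π< b (λ t → F (a ℕ.+ t))) ⊛ F (a ℕ.+ b)                 ≈⟨ ⊛-assoc (Π< a F) (Π< b (λ t → F (a ℕ.+ t))) (F (a ℕ.+ b)) ⟩
  Π< a F ⊛ (Π< b (λ t → F (a ℕ.+ t)) ⊛ F (a ℕ.+ b))                 ∎
  where open ≗-Reasoning

⊛-1-q^-telescope : ∀ a b f →
  f ⊛ onePlus -1ℤ a ⊕ shift a (f ⊛ onePlus -1ℤ b) ≗ f ⊛ onePlus -1ℤ (a ℕ.+ b)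
⊛-1-q^-telescope a b f n = begin
  (f ⊛ onePlus -1ℤ a) n + shift a (f ⊛ onePlus -1ℤ b) n
    ≡⟨ cong₂ _+_ (⊛-onePlus -1ℤ a f n) (shift-cong a (⊛-onePlus -1ℤ b f) n) ⟩
  f n + -1ℤ * shift a f n + shift a (f ⊕ -1ℤ · shift b f) n
    ≡⟨ cong (λ x → f n + -1ℤ * shift a f n + x)
            (trans (shift-⊕ a f _ n) (cong (λ x → shift a f n + x)
                   (trans (shift-· a -1ℤ _ n) (cong (-1ℤ *_) (shift-shift a b f n))))) ⟩
  f n + -1ℤ * shift a f n + (shift a f n + -1ℤ * shift (a ℕ.+ b) f n)
    ≡⟨ cancel (f n) (shift a f n) (shift (a ℕ.+ b) f n) ⟩
  f n + -1ℤ * shift (a ℕ.+ b) f n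
    ≡⟨ ⊛-onePlus -1ℤ (a ℕ.+ b) f n ⟨
  (f ⊛ onePlus -1ℤ (a ℕ.+ b)) n ∎
  where
  open ≡-Reasoning
  cancel : ∀ x y z → x + -1ℤ * y + (y + -1ℤ * z) ≡ x + -1ℤ * z
  cancel = solve-∀

⊛-1-q^0 : ∀ f → f ⊛ onePlus -1ℤ 0 ≗ zeroS
⊛-1-q^0 f n = trans (⊛-onePlus -1ℤ 0 f n) (x-x≡0 (f n))
  where
  x-x≡0 : ∀ x → x + -1ℤ * x ≡ + 0
  x-x≡0 = solve-∀

gaussPoly : ℕ → ℕ → PS
gaussPoly K       zero    = oneS
gaussPoly zero    (suc t) = zeroS
gaussPoly (suc K) (suc t) = gaussPoly K (suc t) ⊕ shift (K ∸ t) (gaussPoly K t)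

gaussPoly-vanishes : ∀ {K t} → K < t → gaussPoly K t ≗ zeroS
gaussPoly-vanishes {zero}  {suc t} _         n = refl
gaussPoly-vanishes {suc K} {suc t} (s≤s K<t) n = cong₂ _+_
  (gaussPoly-vanishes (ℕₚ.m<n⇒m<1+n K<t) n)
  (trans (shift-cong (K ∸ t) (gaussPoly-vanishes K<t) n) (shift-zeroS (K ∸ t) n))

gaussPoly-⊛-qPochs : ∀ {K t} → t ≤ K → gaussPoly K t ⊛ (qPoch t ⊛ qPoch (K ∸ t)) ≗ qPoch K
gaussPoly-⊛-qPochs {K}     {zero}  _         n = trans (⊛-identityˡ (oneS ⊛ qPoch K) n) (⊛-identityˡ (qPoch K) n)
gaussPoly-⊛-qPochs {suc K} {suc t} (s≤s t≤K) = begin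
  (gaussPoly K (suc t) ⊕ shift (K ∸ t) (gaussPoly K t)) ⊛ Q
    ≈⟨ ⊛-distribʳ-⊕ Q (gaussPoly K (suc t)) (shift (K ∸ t) (gaussPoly K t)) ⟩
  gaussPoly K (suc t) ⊛ Q ⊕ shift (K ∸ t) (gaussPoly K t) ⊛ Q
    ≈⟨ (λ n → cong₂ _+_ (unshiftedTerm (ℕₚ.m≤n⇒m<n∨m≡n t≤K) n) (shiftedTerm n)) ⟩
  qPoch K ⊛ o (K ∸ t) ⊕ shift (K ∸ t) (qPoch K ⊛ o (suc t))
    ≈⟨ ⊛-1-q^-telescope (K ∸ t) (suc t) (qPoch K) ⟩
  qPoch K ⊛ o (K ∸ t ℕ.+ suc t)
    ≡⟨ cong (λ e → qPoch K ⊛ o e) (trans (ℕₚ.+-suc (K ∸ t) t) (cong suc (ℕₚ.m∸n+n≡m t≤K))) ⟩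
  qPoch K ⊛ o (suc K) ∎
  where
  open ≗-Reasoning
  o = onePlus -1ℤ
  Q = qPoch (suc t) ⊛ qPoch (K ∸ t)
  unshiftedTerm : t < K ⊎ t ≡ K → gaussPoly K (suc t) ⊛ Q ≗ qPoch K ⊛ o (K ∸ t)
  unshiftedTerm (inj₁ t<K) rewrite ℕₚ.+-∸-assoc 1 t<K = begin
    gaussPoly K (suc t) ⊛ (qPoch (suc t) ⊛ (qPoch (K ∸ suc t) ⊛ o (suc (K ∸ suc t))))
      ≈⟨ ⊛-congˡ (gaussPoly K (suc t)) (⊛-assoc (qPoch (suc t)) (qPoch (K ∸ suc t)) (o (suc (K ∸ suc t)))) ⟨
    gaussPoly K (suc t) ⊛ ((qPoch (suc t) ⊛ qPoch (K ∸ suc t)) ⊛ o (suc (K ∸ suc t)))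
      ≈⟨ ⊛-assoc (gaussPoly K (suc t)) (qPoch (suc t) ⊛ qPoch (K ∸ suc t)) (o (suc (K ∸ suc t))) ⟨
    (gaussPoly K (suc t) ⊛ (qPoch (suc t) ⊛ qPoch (K ∸ suc t))) ⊛ o (suc (K ∸ suc t))
      ≈⟨ ⊛-congʳ (o (suc (K ∸ suc t))) (gaussPoly-⊛-qPochs t<K) ⟩
    qPoch K ⊛ o (suc (K ∸ suc t)) ∎
  unshiftedTerm (inj₂ refl) = begin
    gaussPoly t (suc t) ⊛ Q  ≈⟨ ⊛-congʳ Q (gaussPoly-vanishes (ℕₚ.n<1+n t)) ⟩
    zeroS ⊛ Q                ≈⟨ ⊛-zeroˡ Q ⟩
    zeroS                    ≈⟨ ⊛-1-q^0 (qPoch t) ⟨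
    qPoch t ⊛ o 0            ≡⟨ cong (λ e → qPoch t ⊛ o e) (ℕₚ.n∸n≡0 t) ⟨
    qPoch t ⊛ o (t ∸ t)      ∎
  shiftedTerm : shift (K ∸ t) (gaussPoly K t) ⊛ Q ≗ shift (K ∸ t) (qPoch K ⊛ o (suc t))
  shiftedTerm = begin
    shift (K ∸ t) (gaussPoly K t) ⊛ Q
      ≈⟨ ⊛-shiftˡ (K ∸ t) (gaussPoly K t) Q ⟩
    shift (K ∸ t) (gaussPoly K t ⊛ ((qPoch t ⊛ o (suc t)) ⊛ qPoch (K ∸ t)))
      ≈⟨ shift-cong (K ∸ t) (⊛-congˡ (gaussPoly K t) (xy∙z≈xz∙y (qPoch t) (o (suc t)) (qPoch (K ∸ t)))) ⟩
    shift (K ∸ t) (gaussPoly K t ⊛ ((qPoch t ⊛ qPoch (K ∸ t)) ⊛ o (suc t)))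
      ≈⟨ shift-cong (K ∸ t) (⊛-assoc (gaussPoly K t) (qPoch t ⊛ qPoch (K ∸ t)) (o (suc t))) ⟨
    shift (K ∸ t) ((gaussPoly K t ⊛ (qPoch t ⊛ qPoch (K ∸ t))) ⊛ o (suc t))
      ≈⟨ shift-cong (K ∸ t) (⊛-congʳ (o (suc t)) (gaussPoly-⊛-qPochs t≤K)) ⟩
    shift (K ∸ t) (qPoch K ⊛ o (suc t)) ∎

gauss≗gaussPoly : ∀ {K t} → t ≤ K → gauss K t ≗ gaussPoly K t
gauss≗gaussPoly {K} {t} t≤K n =
  sym (x⊛a≗y⇒x≗y⊛inv-a {x = gaussPoly K t} (qPoch-constant-term (K ∸ t))
        (x⊛a≗y⇒x≗y⊛inv-a {x = gaussPoly K t ⊛ qPoch (K ∸ t)} (qPoch-constant-term t) G⊛Q⊛P≗P) n)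
  where
  open ≗-Reasoning
  G⊛Q⊛P≗P : (gaussPoly K t ⊛ qPoch (K ∸ t)) ⊛ qPoch t ≗ qPoch K
  G⊛Q⊛P≗P = begin
    (gaussPoly K t ⊛ qPoch (K ∸ t)) ⊛ qPoch t  ≈⟨ x∙yz≈xz∙y (gaussPoly K t) (qPoch t) (qPoch (K ∸ t)) ⟨
    gaussPoly K t ⊛ (qPoch t ⊛ qPoch (K ∸ t))  ≈⟨ gaussPoly-⊛-qPochs t≤K ⟩
    qPoch K                                     ∎

-- gaussPoly (d + a) a · (q;q)_a = (q;q)_(d+a) / (q;q)_d = ∏_{d < j ≤ d+a} (1 - q^j), which is 1 below degree d + 1.
gaussPoly≈[<]inv-qPoch : ∀ d a → gaussPoly (d ℕ.+ a) a ≈[< suc d ] inv (qPoch a)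
gaussPoly≈[<]inv-qPoch d a =
  ≈[<]-trans (≗⇒≈[<] (suc d) (x⊛a≗y⇒x≗y⊛inv-a {x = G} (qPoch-constant-term a) G⊛P≗R))
  (≈[<]-trans (⊛-cong-≈[<] {g = inv (qPoch a)} R≈[<]1 (λ _ → refl)) (≗⇒≈[<] (suc d) (⊛-identityˡ (inv (qPoch a)))))
  where
  open ≗-Reasoning
  G = gaussPoly (d ℕ.+ a) a
  R = Π< a (λ t → onePlus -1ℤ (suc (d ℕ.+ t)))
  R≈[<]1 : R ≈[< suc d ] oneS
  R≈[<]1 = Π<-≈[<]-oneS a _ (λ t → ≈[<]-weaken (s≤s (ℕₚ.m≤m+n d t)) (onePlus-≈[<]-oneS -1ℤ (suc (d ℕ.+ t))))
  G⊛P≗R : G ⊛ qPoch a ≗ R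
  G⊛P≗R = ⊛-cancelʳ {x = G ⊛ qPoch a} (qPoch d) (qPoch-constant-term d) (begin
    (G ⊛ qPoch a) ⊛ qPoch d                    ≈⟨ ⊛-assoc G (qPoch a) (qPoch d) ⟩
    G ⊛ (qPoch a ⊛ qPoch d)                    ≡⟨ cong (λ e → G ⊛ (qPoch a ⊛ qPoch e)) (ℕₚ.m+n∸n≡m d a) ⟨
    G ⊛ (qPoch a ⊛ qPoch (d ℕ.+ a ∸ a))        ≈⟨ gaussPoly-⊛-qPochs (ℕₚ.m≤n+m a d) ⟩
    qPoch (d ℕ.+ a)                            ≈⟨ Π<-+ d a _ ⟩
    qPoch d ⊛ R                                ≈⟨ ⊛-comm (qPoch d) R ⟩
    R ⊛ qPoch d                                ∎)

-- Weight-graded lists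

unique-map⁺ : ∀ {f : X → Y} {xs} → (∀ {x y} → x ∈ xs → y ∈ xs → f x ≡ f y → x ≡ y) → Unique xs → Unique (map f xs)
unique-map⁺ injective []            = []
unique-map⁺ injective (x∉xs ∷ uniq) =
  Allₚ.map⁺ (All.tabulate (λ y∈xs fx≡fy → All.lookup x∉xs y∈xs (injective (here refl) (there y∈xs) fx≡fy)))
  ∷ unique-map⁺ (λ x∈ y∈ → injective (there x∈) (there y∈)) uniq

gf : (ℕ → List X) → PS
gf F n = + length (F n)

Graded : (ℕ → List X) → Set
Graded F = ∀ {i j x} → x ∈ F i → x ∈ F j → i ≡ j

length-cartesianProduct : (xs : List X) (ys : List Y) → length (cartesianProduct xs ys) ≡ length xs ℕ.* length ys
length-cartesianProduct []       ys = refl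
length-cartesianProduct (x ∷ xs) ys = trans (Listₚ.length-++ (map (x ,_) ys))
  (cong₂ ℕ._+_ (Listₚ.length-map (x ,_) ys) (length-cartesianProduct xs ys))

concatBelow : ℕ → (ℕ → List X) → List X
concatBelow zero    F = []
concatBelow (suc n) F = concatBelow n F ++ F n

length-concatBelow : ∀ n (F : ℕ → List X) → + length (concatBelow n F) ≡ Σ< n (gf F)
length-concatBelow zero    F = refl
length-concatBelow (suc n) F = begin
  + length (concatBelow n F ++ F n)             ≡⟨ cong +_ (Listₚ.length-++ (concatBelow n F)) ⟩
  + (length (concatBelow n F) ℕ.+ length (F n)) ≡⟨ ℤₚ.pos-+ (length (concatBelow n F)) (length (F n)) ⟩
  + length (concatBelow n F) + gf F n           ≡⟨ cong (_+ gf F n) (length-concatBelow n F) ⟩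
  Σ< n (gf F) + gf F n                          ∎
  where open ≡-Reasoning

∈-concatBelow⁺ : ∀ {n} (F : ℕ → List X) {i x} → i < n → x ∈ F i → x ∈ concatBelow n F
∈-concatBelow⁺ {n = suc n} F {i} (s≤s i≤n) x∈Fi with ℕₚ.m≤n⇒m<n∨m≡n i≤n
... | inj₁ i<n  = ∈-++⁺ˡ (∈-concatBelow⁺ F i<n x∈Fi)
... | inj₂ refl = ∈-++⁺ʳ (concatBelow n F) x∈Fi

∈-concatBelow⁻ : ∀ n (F : ℕ → List X) {x} → x ∈ concatBelow n F → ∃[ i ] i < n × x ∈ F i
∈-concatBelow⁻ (suc n) F x∈ with ∈-++⁻ (concatBelow n F) x∈
... | inj₂ x∈Fn = n , ℕₚ.n<1+n n , x∈Fn
... | inj₁ x∈F<n with ∈-concatBelow⁻ n F x∈F<n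
...   | i , i<n , x∈Fi = i , ℕₚ.m<n⇒m<1+n i<n , x∈Fi

concatBelow-unique : ∀ n (F : ℕ → List X) → (∀ i → Unique (F i)) → Graded F → Unique (concatBelow n F)
concatBelow-unique zero    F unique graded = []
concatBelow-unique (suc n) F unique graded =
  Uniqueₚ.++⁺ (concatBelow-unique n F unique graded) (unique n) disjoint
  where
  disjoint : ∀ {x} → x ∈ concatBelow n F × x ∈ F n → ⊥
  disjoint (x∈F<n , x∈Fn) with ∈-concatBelow⁻ n F x∈F<n
  ... | i , i<n , x∈Fi = ℕₚ.<-irrefl (graded x∈Fi x∈Fn) i<n

delay : ℕ → (ℕ → List X) → ℕ → List X
delay k F n with k ≤? n
... | yes _ = F (n ∸ k)
... | no  _ = []

gf-delay : ∀ k (F : ℕ → List X) → gf (delay k F) ≗ shift k (gf F)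
gf-delay k F n with k ≤? n
... | yes k≤n = sym (shift-≤ k (gf F) k≤n)
... | no  k≰n = sym (shift-< k (gf F) (ℕₚ.≰⇒> k≰n))

∈-delay⁺ : ∀ k (F : ℕ → List X) {n x} → k ≤ n → x ∈ F (n ∸ k) → x ∈ delay k F n
∈-delay⁺ k F {n} k≤n x∈ with k ≤? n
... | yes _   = x∈
... | no  k≰n = contradiction k≤n k≰n

∈-delay⁻ : ∀ k (F : ℕ → List X) n {x} → x ∈ delay k F n → k ≤ n × x ∈ F (n ∸ k)
∈-delay⁻ k F n x∈ with k ≤? n
... | yes k≤n = k≤n , x∈

delay-unique : ∀ k (F : ℕ → List X) n → (∀ j → Unique (F j)) → Unique (delay k F n)
delay-unique k F n unique with k ≤? n
... | yes _ = unique (n ∸ k)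
... | no  _ = []

infixl 6 _∪_
infixr 7 _⊗_

_∪_ : (ℕ → List X) → (ℕ → List X) → ℕ → List X
(F ∪ G) n = F n ++ G n

gf-∪ : (F G : ℕ → List X) → gf (F ∪ G) ≗ gf F ⊕ gf G
gf-∪ F G n = trans (cong +_ (Listₚ.length-++ (F n))) (ℤₚ.pos-+ (length (F n)) (length (G n)))

_⊗_ : (ℕ → List X) → (ℕ → List Y) → ℕ → List (X × Y)
(F ⊗ G) n = concatBelow (suc n) (λ i → cartesianProduct (F i) (G (n ∸ i)))

gf-⊗ : (F : ℕ → List X) (G : ℕ → List Y) → gf (F ⊗ G) ≗ gf F ⊛ gf G
gf-⊗ F G n = trans (length-concatBelow (suc n) _) (Σ<-cong (suc n) λ i →
  trans (cong +_ (length-cartesianProduct (F i) (G (n ∸ i)))) (ℤₚ.pos-* (length (F i)) (length (G (n ∸ i)))))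

∈-⊗⁺ : ∀ (F : ℕ → List X) (G : ℕ → List Y) {i j x y} → x ∈ F i → y ∈ G j → (x , y) ∈ (F ⊗ G) (i ℕ.+ j)
∈-⊗⁺ F G {i} {j} x∈Fi y∈Gj = ∈-concatBelow⁺ _ (s≤s (ℕₚ.m≤m+n i j))
  (∈-cartesianProduct⁺ x∈Fi (subst (_ ∈_) (cong G (sym (ℕₚ.m+n∸m≡n i j))) y∈Gj))

∈-⊗⁻ : ∀ (F : ℕ → List X) (G : ℕ → List Y) n {x y} → (x , y) ∈ (F ⊗ G) n → ∃[ i ] i ≤ n × x ∈ F i × y ∈ G (n ∸ i)
∈-⊗⁻ F G n xy∈ with ∈-concatBelow⁻ (suc n) _ xy∈
... | i , s≤s i≤n , xy∈Fi×G with ∈-cartesianProduct⁻ (F i) (G (n ∸ i)) xy∈Fi×G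
...   | x∈Fi , y∈G = i , i≤n , x∈Fi , y∈G

⊗-graded : (F : ℕ → List X) (G : ℕ → List Y) → Graded F → Graded G → Graded (F ⊗ G)
⊗-graded F G gradedF gradedG {n} {n′} {x , y} xy∈ xy∈′
  with ∈-⊗⁻ F G n xy∈ | ∈-⊗⁻ F G n′ xy∈′
... | i , i≤n , x∈Fi , y∈G | i′ , i′≤n′ , x∈Fi′ , y∈G′ with gradedF x∈Fi x∈Fi′
...   | refl = begin
  n                  ≡⟨ ℕₚ.m+[n∸m]≡n i≤n ⟨
  i ℕ.+ (n ∸ i)      ≡⟨ cong (i ℕ.+_) (gradedG y∈G y∈G′) ⟩
  i ℕ.+ (n′ ∸ i)     ≡⟨ ℕₚ.m+[n∸m]≡n i′≤n′ ⟩
  n′                 ∎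
  where open ≡-Reasoning

⊗-unique : ∀ (F : ℕ → List X) (G : ℕ → List Y) n →
           (∀ i → Unique (F i)) → (∀ j → Unique (G j)) → Graded F → Unique ((F ⊗ G) n)
⊗-unique F G n uniqueF uniqueG gradedF =
  concatBelow-unique (suc n) _ (λ i → Uniqueₚ.cartesianProduct⁺ (uniqueF i) (uniqueG (n ∸ i))) graded
  where
  graded : ∀ {i j xy} → xy ∈ cartesianProduct (F i) (G (n ∸ i)) → xy ∈ cartesianProduct (F j) (G (n ∸ j)) → i ≡ j
  graded {i} {j} xy∈ xy∈′ = gradedF (proj₁ (∈-cartesianProduct⁻ (F i) _ xy∈)) (proj₁ (∈-cartesianProduct⁻ (F j) _ xy∈′))

-- Decreasing lists and partitions into distinct parts from a window

++-injective-separated : ∀ {P Q : X → Set} → (∀ {z} → P z → Q z → ⊥) → ∀ xs xs′ {ys ys′} →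
  All P xs → All P xs′ → All Q ys → All Q ys′ → xs ++ ys ≡ xs′ ++ ys′ → xs ≡ xs′ × ys ≡ ys′
++-injective-separated P∩Q=∅ []       []         _          _            _          _        eq = refl , eq
++-injective-separated P∩Q=∅ []       (x′ ∷ xs′) _          (Px′ ∷ _)    (Qx′ ∷ _)  _        refl = ⊥-elim (P∩Q=∅ Px′ Qx′)
++-injective-separated P∩Q=∅ (x ∷ xs) []         (Px ∷ _)   _            _          (Qx ∷ _) refl = ⊥-elim (P∩Q=∅ Px Qx)
++-injective-separated P∩Q=∅ (x ∷ xs) (x′ ∷ xs′) (_ ∷ Pxs)  (_ ∷ Pxs′)   Qys        Qys′     eq
  with Listₚ.∷-injective eq
... | refl , eq′ = map₁ (cong (x ∷_)) (++-injective-separated P∩Q=∅ xs xs′ Pxs Pxs′ Qys Qys′ eq′)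

Decreasing : List ℕ → Set
Decreasing = AllPairs _>_

strictDec⇒decreasing : ∀ {xs} → StrictDec xs → Decreasing xs
strictDec⇒decreasing []        = []
strictDec⇒decreasing [_]       = [] ∷ []
strictDec⇒decreasing (y<x ∷ s) with strictDec⇒decreasing s
... | y>ys ∷ d = (y<x ∷ All.map (λ z<y → ℕₚ.<-trans z<y y<x) y>ys) ∷ y>ys ∷ d

decreasing⇒strictDec : ∀ {xs} → Decreasing xs → StrictDec xs
decreasing⇒strictDec []                = []
decreasing⇒strictDec ([] ∷ [])         = [_]
decreasing⇒strictDec ((y<x ∷ _) ∷ d)   = y<x ∷ decreasing⇒strictDec d

decreasing-++⁻ : ∀ xs {ys} → Decreasing (xs ++ ys) → Decreasing xs × Decreasing ys × All (λ x → All (x >_) ys) xs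
decreasing-++⁻ []       d                = [] , d , []
decreasing-++⁻ (x ∷ xs) (x>xs++ys ∷ d) with decreasing-++⁻ xs d
... | dxs , dys , xs>ys = Allₚ.++⁻ˡ xs x>xs++ys ∷ dxs , dys , Allₚ.++⁻ʳ xs x>xs++ys ∷ xs>ys

decreasing-length≤ : ∀ {lo hi xs} → Decreasing xs → All (λ y → lo ≤ y × y < hi) xs → length xs ≤ hi ∸ lo
decreasing-length≤ []               []                   = z≤n
decreasing-length≤ (x>xs ∷ d) ((lo≤x , x<hi) ∷ bounds) =
  ℕₚ.<-≤-trans (s≤s (decreasing-length≤ d (All.zipWith (λ ((lo≤y , _) , y<x) → lo≤y , y<x) (bounds , x>xs))))
               (ℕₚ.∸-monoˡ-< x<hi lo≤x)

split-≥ : ∀ m xs → Decreasing xs → ∃[ B ] ∃[ C ] xs ≡ B ++ C × All (m ≤_) B × All (_< m) C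
split-≥ m []       _ = [] , [] , refl , [] , []
split-≥ m (x ∷ xs) (x>xs ∷ d) with m ≤? x
... | yes m≤x with split-≥ m xs d
...   | B , C , refl , m≤B , C<m = x ∷ B , C , refl , m≤x ∷ m≤B , C<m
split-≥ m (x ∷ xs) (x>xs ∷ d) | no m≰x =
  [] , x ∷ xs , refl , [] , x<m ∷ All.map (λ y<x → ℕₚ.<-trans y<x x<m) x>xs
  where x<m = ℕₚ.≰⇒> m≰x

parts≤sum : ∀ xs → All (_≤ sum xs) xs
parts≤sum []       = []
parts≤sum (x ∷ xs) = ℕₚ.m≤m+n x (sum xs) ∷ All.map (λ y≤ → ℕₚ.≤-trans y≤ (ℕₚ.m≤n+m (sum xs) x)) (parts≤sum xs)

data PartCount : Set where
  unrestricted : PartCount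
  exactly      : ℕ → PartCount

HasCount : PartCount → ℕ → Set
HasCount unrestricted _ = ⊤
HasCount (exactly c)  l = l ≡ c

InWindow : ℕ → ℕ → ℕ → Set
InWindow lo len y = lo ≤ y × y < lo ℕ.+ len

inWindow⇔ : ∀ {lo hi y} → lo ≤ hi → (lo ≤ y × y < hi) ⇔ InWindow lo (hi ∸ lo) y
inWindow⇔ lo≤hi = mk⇔ (λ (lo≤y , y<hi) → lo≤y , subst (_ <_) (sym (ℕₚ.m+[n∸m]≡n lo≤hi)) y<hi)
                      (λ (lo≤y , y<)   → lo≤y , subst (_ <_) (ℕₚ.m+[n∸m]≡n lo≤hi) y<)

DistinctPartitionIn : ℕ → ℕ → ℕ → List ℕ → Set
DistinctPartitionIn lo len N xs = Decreasing xs × All (InWindow lo len) xs × sum xs ≡ N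

noParts : ℕ → List (List ℕ)
noParts zero    = [] ∷ []
noParts (suc _) = []

withPart : ℕ → (ℕ → List (List ℕ)) → ℕ → List (List ℕ)
withPart x F N = map (x ∷_) (delay x F N)

distinctParts : (lo len : ℕ) → PartCount → ℕ → List (List ℕ)
distinctParts lo zero      unrestricted      = noParts
distinctParts lo zero      (exactly zero)    = noParts
distinctParts lo zero      (exactly (suc c)) = λ _ → []
distinctParts lo (suc len) unrestricted      =
  distinctParts lo len unrestricted ∪ withPart (lo ℕ.+ len) (distinctParts lo len unrestricted)
distinctParts lo (suc len) (exactly zero)    = distinctParts lo len (exactly zero)
distinctParts lo (suc len) (exactly (suc c)) =
  distinctParts lo len (exactly (suc c)) ∪ withPart (lo ℕ.+ len) (distinctParts lo len (exactly c))

∈-withPart⁻ : ∀ x F N {xs} → xs ∈ withPart x F N → ∃[ ys ] xs ≡ x ∷ ys × x ≤ N × ys ∈ F (N ∸ x)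
∈-withPart⁻ x F N xs∈ with ∈-map⁻ (x ∷_) xs∈
... | ys , ys∈ , refl with ∈-delay⁻ x F N ys∈
...   | x≤N , ys∈′ = ys , refl , x≤N , ys∈′

∈-withPart⁺ : ∀ x F {N ys} → x ≤ N → ys ∈ F (N ∸ x) → x ∷ ys ∈ withPart x F N
∈-withPart⁺ x F x≤N ys∈ = ∈-map⁺ (x ∷_) (∈-delay⁺ x F x≤N ys∈)

withPart-unique : ∀ x F N → (∀ M → Unique (F M)) → Unique (withPart x F N)
withPart-unique x F N unique = Uniqueₚ.map⁺ Listₚ.∷-injectiveʳ (delay-unique x F N unique)

gf-withPart : ∀ x F → gf (withPart x F) ≗ shift x (gf F)
gf-withPart x F N = trans (cong +_ (Listₚ.length-map (x ∷_) (delay x F N))) (gf-delay x F N)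

gf-noParts : gf noParts ≗ oneS
gf-noParts zero    = refl
gf-noParts (suc N) = refl

emptyWindow : ∀ {lo N xs} → DistinctPartitionIn lo 0 N xs → xs ≡ [] × N ≡ 0
emptyWindow (_ , []                    , refl) = refl , refl
emptyWindow (_ , (lo≤y , y<lo+0) ∷ _ , _)     =
  ⊥-elim (ℕₚ.<-irrefl refl (ℕₚ.≤-<-trans lo≤y (subst (_ <_) (ℕₚ.+-identityʳ _) y<lo+0)))

largestOrNot : ∀ {lo len N xs} → DistinctPartitionIn lo (suc len) N xs →
  DistinctPartitionIn lo len N xs ⊎
  ∃[ ys ] xs ≡ lo ℕ.+ len ∷ ys × lo ℕ.+ len ≤ N × DistinctPartitionIn lo len (N ∸ (lo ℕ.+ len)) ys
largestOrNot (d , [] , Σ≡N) = inj₁ (d , [] , Σ≡N)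
largestOrNot {lo} {len} {N} {y ∷ ys} (y>ys ∷ d , (lo≤y , y<lo+1+len) ∷ win , Σ≡N)
  with ℕₚ.m≤n⇒m<n∨m≡n (ℕₚ.≤-pred (subst (y <_) (ℕₚ.+-suc lo len) y<lo+1+len))
... | inj₁ y<lo+len = inj₁ (y>ys ∷ d , (lo≤y , y<lo+len) ∷ below y<lo+len , Σ≡N)
  where
  below : y < lo ℕ.+ len → All (InWindow lo len) ys
  below y<top = All.zipWith (λ ((lo≤z , _) , z<y) → lo≤z , ℕₚ.<-trans z<y y<top) (win , y>ys)
... | inj₂ refl = inj₂ (ys , refl , y≤N , d , All.zipWith (λ ((lo≤z , _) , z<y) → lo≤z , z<y) (win , y>ys) , Σys≡)
  where
  y≤N = subst (y ≤_) Σ≡N (ℕₚ.m≤m+n y (sum ys))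
  Σys≡ = trans (sym (ℕₚ.m+n∸m≡n y (sum ys))) (cong (_∸ y) Σ≡N)

widen : ∀ {lo len N xs} → DistinctPartitionIn lo len N xs → DistinctPartitionIn lo (suc len) N xs
widen {lo} {len} (d , win , Σ≡N) = d , All.map (λ (lo≤y , y<) → lo≤y , ℕₚ.<-≤-trans y< (ℕₚ.+-monoʳ-≤ lo (ℕₚ.n≤1+n len))) win , Σ≡N

addLargest : ∀ {lo len N ys} → lo ℕ.+ len ≤ N → DistinctPartitionIn lo len (N ∸ (lo ℕ.+ len)) ys →
             DistinctPartitionIn lo (suc len) N (lo ℕ.+ len ∷ ys)
addLargest {lo} {len} x≤N (d , win , Σ≡) =
  All.map proj₂ win ∷ d ,
  (ℕₚ.m≤m+n lo len , ℕₚ.+-monoʳ-< lo (ℕₚ.n<1+n len)) ∷ proj₁ (proj₂ (widen (d , win , Σ≡))) ,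
  trans (cong (lo ℕ.+ len ℕ.+_) Σ≡) (ℕₚ.m+[n∸m]≡n x≤N)

∈-distinctParts⁻ : ∀ lo len c N {xs} → xs ∈ distinctParts lo len c N → DistinctPartitionIn lo len N xs × HasCount c (length xs)
∈-distinctParts⁻ lo zero      unrestricted      zero (here refl) = ([] , [] , refl) , tt
∈-distinctParts⁻ lo zero      (exactly zero)    zero (here refl) = ([] , [] , refl) , refl
∈-distinctParts⁻ lo (suc len) (exactly zero)    N    xs∈         = map₁ widen (∈-distinctParts⁻ lo len (exactly zero) N xs∈)
∈-distinctParts⁻ lo (suc len) unrestricted      N    xs∈ with ∈-++⁻ (distinctParts lo len unrestricted N) xs∈
... | inj₁ xs∈′ = map₁ widen (∈-distinctParts⁻ lo len unrestricted N xs∈′)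
... | inj₂ xs∈′ with ∈-withPart⁻ _ _ N xs∈′
...   | ys , refl , x≤N , ys∈ = addLargest x≤N (proj₁ (∈-distinctParts⁻ lo len unrestricted _ ys∈)) , tt
∈-distinctParts⁻ lo (suc len) (exactly (suc c)) N    xs∈ with ∈-++⁻ (distinctParts lo len (exactly (suc c)) N) xs∈
... | inj₁ xs∈′ = map₁ widen (∈-distinctParts⁻ lo len (exactly (suc c)) N xs∈′)
... | inj₂ xs∈′ with ∈-withPart⁻ _ _ N xs∈′
...   | ys , refl , x≤N , ys∈ with ∈-distinctParts⁻ lo len (exactly c) _ ys∈
...     | p , refl = addLargest x≤N p , refl

∈-distinctParts⁺ : ∀ lo len c N {xs} → DistinctPartitionIn lo len N xs → HasCount c (length xs) → xs ∈ distinctParts lo len c N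
∈-distinctParts⁺ lo zero c N p count with emptyWindow p
∈-distinctParts⁺ lo zero unrestricted   _ p _    | refl , refl = here refl
∈-distinctParts⁺ lo zero (exactly zero) _ p _    | refl , refl = here refl
∈-distinctParts⁺ lo (suc len) unrestricted N p _ with largestOrNot p
... | inj₁ p′                    = ∈-++⁺ˡ (∈-distinctParts⁺ lo len unrestricted N p′ tt)
... | inj₂ (ys , refl , x≤N , p′) =
  ∈-++⁺ʳ _ (∈-withPart⁺ _ _ x≤N (∈-distinctParts⁺ lo len unrestricted _ p′ tt))
∈-distinctParts⁺ lo (suc len) (exactly zero) N p count with largestOrNot p
... | inj₁ p′                = ∈-distinctParts⁺ lo len (exactly zero) N p′ count
... | inj₂ (ys , refl , _)   with count
... | ()
∈-distinctParts⁺ lo (suc len) (exactly (suc c)) N p count with largestOrNot p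
... | inj₁ p′                    = ∈-++⁺ˡ (∈-distinctParts⁺ lo len (exactly (suc c)) N p′ count)
... | inj₂ (ys , refl , x≤N , p′) =
  ∈-++⁺ʳ _ (∈-withPart⁺ _ _ x≤N (∈-distinctParts⁺ lo len (exactly c) _ p′ (ℕₚ.suc-injective count)))

distinctParts-graded : ∀ lo len c → Graded (distinctParts lo len c)
distinctParts-graded lo len c {i} {j} xs∈i xs∈j
  with ∈-distinctParts⁻ lo len c i xs∈i | ∈-distinctParts⁻ lo len c j xs∈j
... | (_ , _ , Σ≡i) , _ | (_ , _ , Σ≡j) , _ = trans (sym Σ≡i) Σ≡j

distinctParts-disjoint-withPart : ∀ lo len c N F → Disjoint (distinctParts lo len c N) (withPart (lo ℕ.+ len) F N)
distinctParts-disjoint-withPart lo len c N F (xs∈ , xs∈′) with ∈-withPart⁻ _ F N xs∈′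
... | ys , refl , _ with ∈-distinctParts⁻ lo len c N xs∈
...   | (_ , (_ , x<x) ∷ _ , _) , _ = ℕₚ.<-irrefl refl x<x

distinctParts-unique : ∀ lo len c N → Unique (distinctParts lo len c N)
distinctParts-unique lo zero      unrestricted      zero    = [] ∷ []
distinctParts-unique lo zero      unrestricted      (suc N) = []
distinctParts-unique lo zero      (exactly zero)    zero    = [] ∷ []
distinctParts-unique lo zero      (exactly zero)    (suc N) = []
distinctParts-unique lo zero      (exactly (suc c)) N       = []
distinctParts-unique lo (suc len) (exactly zero)    N       = distinctParts-unique lo len (exactly zero) N
distinctParts-unique lo (suc len) unrestricted      N       =
  Uniqueₚ.++⁺ (distinctParts-unique lo len unrestricted N)
              (withPart-unique _ _ N (distinctParts-unique lo len unrestricted))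
              (distinctParts-disjoint-withPart lo len unrestricted N _)
distinctParts-unique lo (suc len) (exactly (suc c)) N       =
  Uniqueₚ.++⁺ (distinctParts-unique lo len (exactly (suc c)) N)
              (withPart-unique _ _ N (distinctParts-unique lo len (exactly c)))
              (distinctParts-disjoint-withPart lo len (exactly (suc c)) N _)

gf-distinctParts-none : ∀ lo len → gf (distinctParts lo len (exactly 0)) ≗ oneS
gf-distinctParts-none lo zero      = gf-noParts
gf-distinctParts-none lo (suc len) = gf-distinctParts-none lo len

gf-distinctParts-unrestricted : ∀ lo len → gf (distinctParts lo len unrestricted) ≗ Π< len (λ t → onePlus 1ℤ (lo ℕ.+ t))
gf-distinctParts-unrestricted lo zero      = gf-noParts
gf-distinctParts-unrestricted lo (suc len) = begin
  gf (F ∪ withPart (lo ℕ.+ len) F)            ≈⟨ gf-∪ F (withPart (lo ℕ.+ len) F) ⟩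
  gf F ⊕ gf (withPart (lo ℕ.+ len) F)
    ≈⟨ (λ n → cong₂ _+_ (IH n) (trans (gf-withPart (lo ℕ.+ len) F n) (shift-cong (lo ℕ.+ len) IH n))) ⟩
  P ⊕ shift (lo ℕ.+ len) P                    ≈⟨ (λ n → cong (λ x → P n + x) (sym (ℤₚ.*-identityˡ _))) ⟩
  P ⊕ 1ℤ · shift (lo ℕ.+ len) P               ≈⟨ ⊛-onePlus 1ℤ (lo ℕ.+ len) P ⟨
  P ⊛ onePlus 1ℤ (lo ℕ.+ len)                 ∎
  where
  open ≗-Reasoning
  F = distinctParts lo len unrestricted
  P = Π< len (λ t → onePlus 1ℤ (lo ℕ.+ t))
  IH = gf-distinctParts-unrestricted lo len

-- t·lo + C(t,2) = lo + (lo + 1) + … + (lo + t - 1) is the least weight of t distinct parts ≥ lo.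
gf-distinctParts-exactly : ∀ lo len t → gf (distinctParts lo len (exactly t)) ≗ shift (t ℕ.* lo ℕ.+ tri t) (gaussPoly len t)
gf-distinctParts-exactly lo len       zero    = gf-distinctParts-none lo len
gf-distinctParts-exactly lo zero      (suc t) = λ n → sym (shift-zeroS (suc t ℕ.* lo ℕ.+ tri (suc t)) n)
gf-distinctParts-exactly lo (suc len) (suc t) = begin
  gf (distinctParts lo len (exactly (suc t)) ∪ withPart (lo ℕ.+ len) (distinctParts lo len (exactly t)))
    ≈⟨ gf-∪ (distinctParts lo len (exactly (suc t))) _ ⟩
  gf (distinctParts lo len (exactly (suc t))) ⊕ gf (withPart (lo ℕ.+ len) (distinctParts lo len (exactly t)))
    ≈⟨ (λ n → cong₂ _+_ (gf-distinctParts-exactly lo len (suc t) n)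
                        (trans (gf-withPart (lo ℕ.+ len) (distinctParts lo len (exactly t)) n)
                               (shift-cong (lo ℕ.+ len) (gf-distinctParts-exactly lo len t) n))) ⟩
  shift E₁ (gaussPoly len (suc t)) ⊕ shift (lo ℕ.+ len) (shift E₀ (gaussPoly len t))
    ≈⟨ (λ n → cong (λ x → shift E₁ (gaussPoly len (suc t)) n + x) (realign (ℕₚ.≤-<-connex t len) n)) ⟩
  shift E₁ (gaussPoly len (suc t)) ⊕ shift E₁ (shift (len ∸ t) (gaussPoly len t))
    ≈⟨ shift-⊕ E₁ (gaussPoly len (suc t)) _ ⟨
  shift E₁ (gaussPoly (suc len) (suc t)) ∎
  where
  open ≗-Reasoning
  E₀ = t ℕ.* lo ℕ.+ tri t
  E₁ = suc t ℕ.* lo ℕ.+ tri (suc t)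
  exponents : ∀ lo t d x → lo ℕ.+ (t ℕ.+ d) ℕ.+ (t ℕ.* lo ℕ.+ x) ≡ lo ℕ.+ t ℕ.* lo ℕ.+ (t ℕ.+ x) ℕ.+ d
  exponents = ℕ-Ring.solve-∀
  realign : t ≤ len ⊎ len < t → shift (lo ℕ.+ len) (shift E₀ (gaussPoly len t)) ≗ shift E₁ (shift (len ∸ t) (gaussPoly len t))
  realign (inj₁ t≤len) = begin
    shift (lo ℕ.+ len) (shift E₀ (gaussPoly len t))  ≈⟨ shift-shift (lo ℕ.+ len) E₀ _ ⟩
    shift (lo ℕ.+ len ℕ.+ E₀) (gaussPoly len t)      ≡⟨ cong (λ e → shift e (gaussPoly len t)) shifted ⟩
    shift (E₁ ℕ.+ (len ∸ t)) (gaussPoly len t)       ≈⟨ shift-shift E₁ (len ∸ t) _ ⟨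
    shift E₁ (shift (len ∸ t) (gaussPoly len t))     ∎
    where
    shifted : lo ℕ.+ len ℕ.+ E₀ ≡ E₁ ℕ.+ (len ∸ t)
    shifted = trans (cong (λ l → lo ℕ.+ l ℕ.+ E₀) (sym (ℕₚ.m+[n∸m]≡n t≤len))) (exponents lo t (len ∸ t) (tri t))
  realign (inj₂ len<t) n = trans (vanish (lo ℕ.+ len) (vanish E₀ (gaussPoly-vanishes len<t)) n)
                                 (sym (vanish E₁ (vanish (len ∸ t) (gaussPoly-vanishes len<t)) n))
    where
    vanish : ∀ e {f} → f ≗ zeroS → shift e f ≗ zeroS
    vanish e f≗0 n = trans (shift-cong e f≗0 n) (shift-zeroS e n)

-- Partitions with a fixed hook in column m

allPos⇒All : ∀ {xs} → AllPos xs → All (1 ≤_) xs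
allPos⇒All []         = []
allPos⇒All (p ∷ ps)   = p ∷ allPos⇒All ps

All⇒allPos : ∀ {xs} → All (1 ≤_) xs → AllPos xs
All⇒allPos []         = []
All⇒allPos (p ∷ ps)   = p ∷ All⇒allPos ps

splitAt-lookup : ∀ (xs : List X) i → ∃[ A ] ∃[ R ] xs ≡ A ++ lookup xs i ∷ R × length A ≡ toℕ i
splitAt-lookup (x ∷ xs) Fin.zero    = [] , xs , refl , refl
splitAt-lookup (x ∷ xs) (Fin.suc i) with splitAt-lookup xs i
... | A , R , xs≡ , |A|≡i = x ∷ A , R , cong (x ∷_) xs≡ , cong suc |A|≡i

lookup-++-∷ : ∀ A (x : X) R → ∃[ i ] toℕ i ≡ length A × lookup (A ++ x ∷ R) i ≡ x
lookup-++-∷ []      x R = Fin.zero , refl , refl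
lookup-++-∷ (a ∷ A) x R with lookup-++-∷ A x R
... | i , i≡|A| , lookup≡x = Fin.suc i , cong suc i≡|A| , lookup≡x

module FixedHook (m k : ℕ) (h : ℤ) (1≤m : 1 ≤ m) (m≤k : m ≤ k) where

  -- If λ_s = k and t parts lie in [m, k), then λ'_m = s + t, so h_{s,m} = s + h says s - 1 = largeCount t.
  largeCount : ℕ → ℤ
  largeCount t = + t + + k - h - + m

  -- Row s = a + 1 has part x and hook length s + h in column m.
  FixedHookAt : List ℕ → ℕ → ℕ → Set
  FixedHookAt lam x a = hook lam x (suc a) m ≡ + suc a + h

  record Admissible (A B C : List ℕ) : Set where
    field
      large-decreasing  : Decreasing A
      large-bounds      : All (k <_) A
      medium-decreasing : Decreasing B
      medium-bounds     : All (λ y → m ≤ y × y < k) B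
      small-decreasing  : Decreasing C
      small-bounds      : All (λ y → 1 ≤ y × y < m) C

  Decomposed : ℕ → List ℕ → Set
  Decomposed n lam = ∃[ A ] ∃[ B ] ∃[ C ]
    lam ≡ A ++ k ∷ B ++ C × Admissible A B C × + length A ≡ largeCount (length B) × sum lam ≡ n

  conj-glue : ∀ A B C → All (k <_) A → All (m ≤_) B → All (_< m) C → conj (A ++ k ∷ B ++ C) m ≡ length A ℕ.+ suc (length B)
  conj-glue A B C k<A m≤B C<m = begin
    length (filter (m ≤?_) (A ++ (k ∷ B) ++ C))
      ≡⟨ cong length (Listₚ.filter-++ (m ≤?_) A ((k ∷ B) ++ C)) ⟩
    length (filter (m ≤?_) A ++ filter (m ≤?_) ((k ∷ B) ++ C))
      ≡⟨ cong (λ xs → length (filter (m ≤?_) A ++ xs)) (Listₚ.filter-++ (m ≤?_) (k ∷ B) C) ⟩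
    length (filter (m ≤?_) A ++ filter (m ≤?_) (k ∷ B) ++ filter (m ≤?_) C)
      ≡⟨ cong₂ (λ xs ys → length (xs ++ ys)) (Listₚ.filter-all (m ≤?_) (All.map (λ k<y → ℕₚ.≤-trans m≤k (ℕₚ.<⇒≤ k<y)) k<A))
           (cong₂ _++_ (Listₚ.filter-all (m ≤?_) (m≤k ∷ m≤B)) (Listₚ.filter-none (m ≤?_) (All.map ℕₚ.<⇒≱ C<m))) ⟩
    length (A ++ (k ∷ B) ++ [])
      ≡⟨ Listₚ.length-++ A ⟩
    length A ℕ.+ length ((k ∷ B) ++ [])
      ≡⟨ cong (λ xs → length A ℕ.+ length xs) (Listₚ.++-identityʳ (k ∷ B)) ⟩
    length A ℕ.+ suc (length B) ∎
    where open ≡-Reasoning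

  fixedHook⇔ : ∀ A B C → All (k <_) A → All (m ≤_) B → All (_< m) C →
               FixedHookAt (A ++ k ∷ B ++ C) k (length A) ⇔ (+ length A ≡ largeCount (length B))
  fixedHook⇔ A B C k<A m≤B C<m = mk⇔
    (λ fixed → sym (ℤₚ.i-j≡0⇒i≡j _ _ (trans (sym excess) (ℤₚ.i≡j⇒i-j≡0 fixed))))
    (λ a≡L → ℤₚ.i-j≡0⇒i≡j _ _ (trans excess (ℤₚ.i≡j⇒i-j≡0 (sym a≡L))))
    where
    a = length A
    t = length B
    identity : ∀ K A T M H → K + (A + (+ 1 + T)) - (+ 1 + A) - M + + 1 - (+ 1 + A + H) ≡ (T + K - H - M) - A
    identity = solve-∀
    excess : hook (A ++ k ∷ B ++ C) k (suc a) m - (+ suc a + h) ≡ largeCount t - + a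
    excess rewrite conj-glue A B C k<A m≤B C<m | ℤₚ.pos-+ a (suc t) | ℤₚ.pos-+ 1 t | ℤₚ.pos-+ 1 a =
      identity (+ k) (+ a) (+ t) (+ m) h

  sum-glue : ∀ A B C → sum (A ++ k ∷ B ++ C) ≡ k ℕ.+ ((sum A ℕ.+ sum C) ℕ.+ sum B)
  sum-glue A B C = trans (sum-++ A (k ∷ B ++ C)) (trans (cong (λ s → sum A ℕ.+ (k ℕ.+ s)) (sum-++ B C))
    (regroup (sum A) (sum B) (sum C) k))
    where
    regroup : ∀ a b c k → a ℕ.+ (k ℕ.+ (b ℕ.+ c)) ≡ k ℕ.+ ((a ℕ.+ c) ℕ.+ b)
    regroup = ℕ-Ring.solve-∀

  glue-decreasing : ∀ {A B C} → Admissible A B C → Decreasing (A ++ k ∷ B ++ C)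
  glue-decreasing {A} {B} {C} adm = AllPairsₚ.++⁺ large-decreasing (BC<k ∷ BC-decreasing) (All.map above large-bounds)
    where
    open Admissible adm
    BC<k : All (_< k) (B ++ C)
    BC<k = Allₚ.++⁺ (All.map proj₂ medium-bounds) (All.map (λ (_ , y<m) → ℕₚ.<-≤-trans y<m m≤k) small-bounds)
    BC-decreasing : Decreasing (B ++ C)
    BC-decreasing = AllPairsₚ.++⁺ medium-decreasing small-decreasing
      (All.map (λ (m≤x , _) → All.map (λ (_ , y<m) → ℕₚ.<-≤-trans y<m m≤x) small-bounds) medium-bounds)
    above : ∀ {x} → k < x → All (_< x) (k ∷ B ++ C)
    above k<x = k<x ∷ All.map (λ y<k → ℕₚ.<-trans y<k k<x) BC<k

  glue-positive : ∀ {A B C} → Admissible A B C → All (1 ≤_) (A ++ k ∷ B ++ C)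
  glue-positive adm = Allₚ.++⁺ (All.map (ℕₚ.≤-<-trans z≤n) large-bounds)
    (ℕₚ.≤-trans 1≤m m≤k ∷ Allₚ.++⁺ (All.map (λ (m≤y , _) → ℕₚ.≤-trans 1≤m m≤y) medium-bounds) (All.map proj₁ small-bounds))
    where open Admissible adm

  glue-tail≤k : ∀ {A B C} → Admissible A B C → All (_≤ k) (k ∷ B ++ C)
  glue-tail≤k adm = ℕₚ.≤-refl ∷ Allₚ.++⁺ (All.map (ℕₚ.<⇒≤ ∘′ proj₂) medium-bounds)
                                         (All.map (λ (_ , y<m) → ℕₚ.≤-trans (ℕₚ.<⇒≤ y<m) m≤k) small-bounds)
    where open Admissible adm

  glue-injective : ∀ {A B C A′ B′ C′} → Admissible A B C → Admissible A′ B′ C′ →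
                   A ++ k ∷ B ++ C ≡ A′ ++ k ∷ B′ ++ C′ → A ≡ A′ × B ≡ B′ × C ≡ C′
  glue-injective {A} {B} {C} {A′} {B′} {C′} adm adm′ eq
    with ++-injective-separated (λ k<z z≤k → ℕₚ.<⇒≱ k<z z≤k) A A′
           (Admissible.large-bounds adm) (Admissible.large-bounds adm′) (glue-tail≤k adm) (glue-tail≤k adm′) eq
  ... | A≡A′ , kBC≡kB′C′
    with ++-injective-separated (λ m≤z z<m → ℕₚ.<⇒≱ z<m m≤z) B B′
           (All.map proj₁ (Admissible.medium-bounds adm)) (All.map proj₁ (Admissible.medium-bounds adm′))
           (All.map proj₂ (Admissible.small-bounds adm)) (All.map proj₂ (Admissible.small-bounds adm′))
           (Listₚ.∷-injectiveʳ kBC≡kB′C′)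
  ...   | B≡B′ , C≡C′ = A≡A′ , B≡B′ , C≡C′

  decompose-glued : ∀ A R → Decreasing (A ++ k ∷ R) → All (1 ≤_) (A ++ k ∷ R) → FixedHookAt (A ++ k ∷ R) k (length A) →
                    ∃[ B ] ∃[ C ] R ≡ B ++ C × Admissible A B C × + length A ≡ largeCount (length B)
  decompose-glued A R decreasing positive fixed with decreasing-++⁻ A decreasing
  ... | decA , k>R ∷ decR , A>kR with split-≥ m R decR
  ...   | B , C , refl , m≤B , C<m with decreasing-++⁻ B decR
  ...     | decB , decC , _ = B , C , refl , adm , Equivalence.to (fixedHook⇔ A B C (Admissible.large-bounds adm) m≤B C<m) fixed
    where
    adm : Admissible A B C
    adm = record
      { large-decreasing  = decA
      ; large-bounds      = All.map (λ { (k<x ∷ _) → k<x }) A>kR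
      ; medium-decreasing = decB
      ; medium-bounds     = All.zip (m≤B , Allₚ.++⁻ˡ B k>R)
      ; small-decreasing  = decC
      ; small-bounds      = All.zip (Allₚ.++⁻ʳ B (All.tail (Allₚ.++⁻ʳ A positive)) , C<m)
      }

  qualifies⇒decomposed : ∀ {n lam} → Qualifies m k h n lam → Decomposed n lam
  qualifies⇒decomposed {n} {lam} ((strict , positive , Σ≡n) , i , lam[i]≡k , fixed) =
    let A , R , lam≡ , |A|≡i = splitAt-lookup lam i
        lam≡AkR = trans lam≡ (cong (λ x → A ++ x ∷ R) lam[i]≡k)
        B , C , R≡BC , adm , hooked = decompose-glued A R
          (subst Decreasing lam≡AkR (strictDec⇒decreasing strict))
          (subst (All (1 ≤_)) lam≡AkR (allPos⇒All positive))
          (subst (λ l → FixedHookAt l k (length A)) lam≡AkR (subst₂ (FixedHookAt lam) lam[i]≡k (sym |A|≡i) fixed))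
    in A , B , C , trans lam≡AkR (cong (λ r → A ++ k ∷ r) R≡BC) , adm , hooked , Σ≡n

  decomposed⇒qualifies : ∀ {n lam} → Decomposed n lam → Qualifies m k h n lam
  decomposed⇒qualifies (A , B , C , refl , adm , hooked , Σ≡n) =
    let i , i≡|A| , lam[i]≡k = lookup-++-∷ A k (B ++ C)
        open Admissible adm
    in (decreasing⇒strictDec (glue-decreasing adm) , All⇒allPos (glue-positive adm) , Σ≡n) ,
       i , lam[i]≡k ,
       subst₂ (FixedHookAt (A ++ k ∷ B ++ C)) (sym lam[i]≡k) (sym i≡|A|)
         (Equivalence.from (fixedHook⇔ A B C large-bounds (All.map proj₁ medium-bounds) (All.map proj₂ small-bounds)) hooked)

  Triple : Set
  Triple = (List ℕ × List ℕ) × List ℕ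

  glue : Triple → List ℕ
  glue ((A , C) , B) = A ++ k ∷ B ++ C

  -- The parts above k of a partition of n are at most n, so the window [k + 1, k + 1 + n + a) misses
  -- none of them; its length n + a is chosen so that the Gaussian polynomial it produces agrees with
  -- 1/(q;q)_a up to degree n.
  largeParts : ℕ → ℕ → ℕ → List (List ℕ)
  largeParts n a = distinctParts (suc k) (n ℕ.+ a) (exactly a)

  smallParts : ℕ → List (List ℕ)
  smallParts = distinctParts 1 (m ∸ 1) unrestricted

  mediumParts : ℕ → ℕ → List (List ℕ)
  mediumParts t = distinctParts m (k ∸ m) (exactly t)

  -- A triple ((A , C) , B) is ordered like the factors 1/(q;q)_a, (-q;q)_(m-1), [k-m choose t]_q of the summand.
  triples : ℕ → ℕ → ℕ → ℕ → List Triple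
  triples n a t = (largeParts n a ⊗ smallParts) ⊗ mediumParts t

  candidatesWith : ℤ → ℕ → ℕ → List (List ℕ)
  candidatesWith (+ a)    t n = map glue (delay k (triples n a t) n)
  candidatesWith -[1+ _ ] t n = []

  candidates : ℕ → List (List ℕ)
  candidates n = concatBelow (suc (k ∸ m)) (λ t → candidatesWith (largeCount t) t n)

  ∈-triples⁻ : ∀ {n a t A B C} → ((A , C) , B) ∈ delay k (triples n a t) n →
               Admissible A B C × length A ≡ a × length B ≡ t × sum (A ++ k ∷ B ++ C) ≡ n
  ∈-triples⁻ {n} {a} {t} {A} {B} {C} x∈ with ∈-delay⁻ k (triples n a t) n x∈
  ... | k≤n , x∈′ with ∈-⊗⁻ (largeParts n a ⊗ smallParts) (mediumParts t) (n ∸ k) x∈′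
  ...   | i , i≤n∸k , AC∈ , B∈ with ∈-⊗⁻ (largeParts n a) smallParts i AC∈
  ...     | j , j≤i , A∈ , C∈
    with ∈-distinctParts⁻ (suc k) (n ℕ.+ a) (exactly a) j A∈
       | ∈-distinctParts⁻ 1 (m ∸ 1) unrestricted (i ∸ j) C∈
       | ∈-distinctParts⁻ m (k ∸ m) (exactly t) (n ∸ k ∸ i) B∈
  ...       | (decA , winA , ΣA) , |A|≡a | (decC , winC , ΣC) , _ | (decB , winB , ΣB) , |B|≡t = adm , |A|≡a , |B|≡t , total
    where
    adm : Admissible A B C
    adm = record
      { large-decreasing  = decA
      ; large-bounds      = All.map proj₁ winA
      ; medium-decreasing = decB
      ; medium-bounds     = All.map (Equivalence.from (inWindow⇔ m≤k)) winB
      ; small-decreasing  = decC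
      ; small-bounds      = All.map (Equivalence.from (inWindow⇔ 1≤m)) winC
      }
    ΣAC : sum A ℕ.+ sum C ≡ i
    ΣAC = trans (cong₂ ℕ._+_ ΣA ΣC) (ℕₚ.m+[n∸m]≡n j≤i)
    total : sum (A ++ k ∷ B ++ C) ≡ n
    total = begin
      sum (A ++ k ∷ B ++ C)                          ≡⟨ sum-glue A B C ⟩
      k ℕ.+ ((sum A ℕ.+ sum C) ℕ.+ sum B)            ≡⟨ cong (λ s → k ℕ.+ (s ℕ.+ sum B)) ΣAC ⟩
      k ℕ.+ (i ℕ.+ sum B)                            ≡⟨ cong (λ s → k ℕ.+ (i ℕ.+ s)) ΣB ⟩
      k ℕ.+ (i ℕ.+ (n ∸ k ∸ i))                      ≡⟨ cong (k ℕ.+_) (ℕₚ.m+[n∸m]≡n i≤n∸k) ⟩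
      k ℕ.+ (n ∸ k)                                  ≡⟨ ℕₚ.m+[n∸m]≡n k≤n ⟩
      n                                              ∎
      where open ≡-Reasoning

  medium : ∀ {n lam} → Decomposed n lam → List ℕ
  medium (_ , B , _) = B

  ∈-candidatesWith⁻ : ∀ {t n lam} → lam ∈ candidatesWith (largeCount t) t n → Σ (Decomposed n lam) (λ d → length (medium d) ≡ t)
  ∈-candidatesWith⁻ {t} {n} {lam} = decompose (largeCount t) refl
    where
    decompose : ∀ z → z ≡ largeCount t → lam ∈ candidatesWith z t n → Σ (Decomposed n lam) (λ d → length (medium d) ≡ t)
    decompose (+ a) a≡L lam∈ with ∈-map⁻ glue lam∈
    ... | ((A , C) , B) , x∈ , refl with ∈-triples⁻ x∈
    ...   | adm , refl , refl , Σ≡n = (A , B , C , refl , adm , a≡L , Σ≡n) , refl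

  ∈-candidates⁻ : ∀ {n lam} → lam ∈ candidates n → Decomposed n lam
  ∈-candidates⁻ {n} lam∈ with ∈-concatBelow⁻ (suc (k ∸ m)) _ lam∈
  ... | t , _ , lam∈t = proj₁ (∈-candidatesWith⁻ lam∈t)

  ∈-candidates⁺ : ∀ {n lam} → Decomposed n lam → lam ∈ candidates n
  ∈-candidates⁺ {n} (A , B , C , refl , adm , hooked , Σ≡n) =
    ∈-concatBelow⁺ _ (s≤s (decreasing-length≤ medium-decreasing medium-bounds))
      (subst (λ z → A ++ k ∷ B ++ C ∈ candidatesWith z (length B) n) hooked
        (∈-map⁺ glue (∈-delay⁺ k (triples n (length A) (length B)) k≤n
          (subst (λ w → ((A , C) , B) ∈ triples n (length A) (length B) w) weight ACB∈))))
    where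
    open Admissible adm
    n≡ : n ≡ k ℕ.+ ((sum A ℕ.+ sum C) ℕ.+ sum B)
    n≡ = trans (sym Σ≡n) (sum-glue A B C)
    k≤n : k ≤ n
    k≤n = subst (k ≤_) (sym n≡) (ℕₚ.m≤m+n k _)
    weight : (sum A ℕ.+ sum C) ℕ.+ sum B ≡ n ∸ k
    weight = trans (sym (ℕₚ.m+n∸m≡n k _)) (cong (_∸ k) (sym n≡))
    ΣA≤n : sum A ≤ n
    ΣA≤n = subst (sum A ≤_) (sym n≡) (ℕₚ.≤-trans (ℕₚ.≤-trans (ℕₚ.m≤m+n (sum A) (sum C)) (ℕₚ.m≤m+n _ (sum B))) (ℕₚ.m≤n+m _ k))
    n≤k+[n+a] : n ≤ k ℕ.+ (n ℕ.+ length A)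
    n≤k+[n+a] = ℕₚ.≤-trans (ℕₚ.m≤m+n n _) (ℕₚ.m≤n+m _ k)
    A∈ : A ∈ largeParts n (length A) (sum A)
    A∈ = ∈-distinctParts⁺ (suc k) (n ℕ.+ length A) (exactly (length A)) (sum A) (large-decreasing , window , refl) refl
      where
      window : All (InWindow (suc k) (n ℕ.+ length A)) A
      window = All.zipWith (λ (k<y , y≤ΣA) → k<y , s≤s (ℕₚ.≤-trans (ℕₚ.≤-trans y≤ΣA ΣA≤n) n≤k+[n+a]))
                           (large-bounds , parts≤sum A)
    C∈ : C ∈ smallParts (sum C)
    C∈ = ∈-distinctParts⁺ 1 (m ∸ 1) unrestricted (sum C)
           (small-decreasing , All.map (Equivalence.to (inWindow⇔ 1≤m)) small-bounds , refl) tt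
    B∈ : B ∈ mediumParts (length B) (sum B)
    B∈ = ∈-distinctParts⁺ m (k ∸ m) (exactly (length B)) (sum B)
           (medium-decreasing , All.map (Equivalence.to (inWindow⇔ m≤k)) medium-bounds , refl) refl
    ACB∈ : ((A , C) , B) ∈ triples n (length A) (length B) ((sum A ℕ.+ sum C) ℕ.+ sum B)
    ACB∈ = ∈-⊗⁺ (largeParts n (length A) ⊗ smallParts) (mediumParts (length B))
             (∈-⊗⁺ (largeParts n (length A)) smallParts A∈ C∈) B∈

  triples-unique : ∀ n a t w → Unique (triples n a t w)
  triples-unique n a t w =
    ⊗-unique (largeParts n a ⊗ smallParts) (mediumParts t) w
      (λ i → ⊗-unique (largeParts n a) smallParts i
               (distinctParts-unique (suc k) (n ℕ.+ a) (exactly a)) (distinctParts-unique 1 (m ∸ 1) unrestricted)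
               (distinctParts-graded (suc k) (n ℕ.+ a) (exactly a)))
      (distinctParts-unique m (k ∸ m) (exactly t))
      (⊗-graded (largeParts n a) smallParts
        (distinctParts-graded (suc k) (n ℕ.+ a) (exactly a)) (distinctParts-graded 1 (m ∸ 1) unrestricted))

  candidatesWith-unique : ∀ z t n → Unique (candidatesWith z t n)
  candidatesWith-unique (+ a)    t n = unique-map⁺ glue-injectiveOn (delay-unique k (triples n a t) n (triples-unique n a t))
    where
    glue-injectiveOn : ∀ {x y} → x ∈ delay k (triples n a t) n → y ∈ delay k (triples n a t) n → glue x ≡ glue y → x ≡ y
    glue-injectiveOn {(A , C) , B} {(A′ , C′) , B′} x∈ y∈ eq
      with glue-injective (proj₁ (∈-triples⁻ x∈)) (proj₁ (∈-triples⁻ y∈)) eq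
    ... | refl , refl , refl = refl
  candidatesWith-unique -[1+ _ ] t n = []

  candidates-unique : ∀ n → Unique (candidates n)
  candidates-unique n = concatBelow-unique (suc (k ∸ m)) _ (λ t → candidatesWith-unique (largeCount t) t n) graded
    where
    graded : ∀ {t t′ lam} → lam ∈ candidatesWith (largeCount t) t n → lam ∈ candidatesWith (largeCount t′) t′ n → t ≡ t′
    graded lam∈ lam∈′ with ∈-candidatesWith⁻ lam∈ | ∈-candidatesWith⁻ lam∈′
    ... | (A , B , C , refl , adm , _) , refl | (A′ , B′ , C′ , eq , adm′ , _) , refl =
      cong length (proj₁ (proj₂ (glue-injective adm adm′ eq)))

  rhsExponent : ℕ → ℤ
  rhsExponent t = + t * (+ k + + m) + + k * (+ k - h - + m + + 1) + binom2 (+ t + + k - + m + + 1 - h) + binom2 (+ t)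

  exponent≡ : ∀ a t → + a ≡ largeCount t → rhsExponent t ≡ + (k ℕ.+ ((a ℕ.* suc k ℕ.+ tri a) ℕ.+ (t ℕ.* m ℕ.+ tri t)))
  exponent≡ a t a≡L = begin
    + t * (+ k + + m) + + k * (+ k - h - + m + + 1) + binom2 (+ t + + k - + m + + 1 - h) + + tri t
      ≡⟨ cong₂ (λ x y → + t * (+ k + + m) + + k * x + binom2 y + + tri t) factor≡ argument≡ ⟩
    + t * (+ k + + m) + + k * (+ a - + t + + 1) + + (a ℕ.+ tri a) + + tri t
      ≡⟨ cong (λ x → + t * (+ k + + m) + + k * (+ a - + t + + 1) + x + + tri t) (ℤₚ.pos-+ a (tri a)) ⟩
    + t * (+ k + + m) + + k * (+ a - + t + + 1) + (+ a + + tri a) + + tri t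
      ≡⟨ regroup (+ k) (+ a) (+ t) (+ m) (+ tri a) (+ tri t) ⟩
    + k + ((+ a * (+ 1 + + k) + + tri a) + (+ t * + m + + tri t))
      ≡⟨ embed ⟨
    + (k ℕ.+ ((a ℕ.* suc k ℕ.+ tri a) ℕ.+ (t ℕ.* m ℕ.+ tri t))) ∎
    where
    open ≡-Reasoning
    shuffle₁ : ∀ T K M H → T + K - M + + 1 - H ≡ + 1 + (T + K - H - M)
    shuffle₁ = solve-∀
    shuffle₂ : ∀ T K M H → K - H - M + + 1 ≡ (T + K - H - M) - T + + 1
    shuffle₂ = solve-∀
    regroup : ∀ K A T M X Y → T * (K + M) + K * (A - T + + 1) + (A + X) + Y ≡ K + ((A * (+ 1 + K) + X) + (T * M + Y))
    regroup = solve-∀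
    argument≡ : + t + + k - + m + + 1 - h ≡ + suc a
    argument≡ = trans (shuffle₁ (+ t) (+ k) (+ m) h) (trans (cong (λ x → + 1 + x) (sym a≡L)) (sym (ℤₚ.pos-+ 1 a)))
    factor≡ : + k - h - + m + + 1 ≡ + a - + t + + 1
    factor≡ = trans (shuffle₂ (+ t) (+ k) (+ m) h) (cong (λ x → x - + t + + 1) (sym a≡L))
    embed : + (k ℕ.+ ((a ℕ.* suc k ℕ.+ tri a) ℕ.+ (t ℕ.* m ℕ.+ tri t))) ≡
            + k + ((+ a * (+ 1 + + k) + + tri a) + (+ t * + m + + tri t))
    embed = begin
      + (k ℕ.+ ((a ℕ.* suc k ℕ.+ tri a) ℕ.+ (t ℕ.* m ℕ.+ tri t)))
        ≡⟨ ℤₚ.pos-+ k _ ⟩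
      + k + + ((a ℕ.* suc k ℕ.+ tri a) ℕ.+ (t ℕ.* m ℕ.+ tri t))
        ≡⟨ cong (λ x → + k + x) (ℤₚ.pos-+ (a ℕ.* suc k ℕ.+ tri a) _) ⟩
      + k + (+ (a ℕ.* suc k ℕ.+ tri a) + + (t ℕ.* m ℕ.+ tri t))
        ≡⟨ cong₂ (λ x y → + k + (x + y))
             (trans (ℤₚ.pos-+ (a ℕ.* suc k) (tri a))
                    (cong (_+ + tri a) (trans (ℤₚ.pos-* a (suc k)) (cong (λ x → + a * x) (ℤₚ.pos-+ 1 k)))))
             (trans (ℤₚ.pos-+ (t ℕ.* m) (tri t)) (cong (_+ + tri t) (ℤₚ.pos-* t m))) ⟩
      + k + ((+ a * (+ 1 + + k) + + tri a) + (+ t * + m + + tri t)) ∎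

  gf-triples : ∀ n a t → gf (triples n a t) ≗
    shift ((a ℕ.* suc k ℕ.+ tri a) ℕ.+ (t ℕ.* m ℕ.+ tri t)) ((gaussPoly (n ℕ.+ a) a ⊛ negqPoch (m ∸ 1)) ⊛ gaussPoly (k ∸ m) t)
  gf-triples n a t = begin
    gf ((largeParts n a ⊗ smallParts) ⊗ mediumParts t)
      ≈⟨ gf-⊗ (largeParts n a ⊗ smallParts) (mediumParts t) ⟩
    gf (largeParts n a ⊗ smallParts) ⊛ gf (mediumParts t)
      ≈⟨ ⊛-congʳ (gf (mediumParts t)) (gf-⊗ (largeParts n a) smallParts) ⟩
    (gf (largeParts n a) ⊛ gf smallParts) ⊛ gf (mediumParts t)
      ≈⟨ ⊛-cong (⊛-cong (gf-distinctParts-exactly (suc k) (n ℕ.+ a) a) (gf-distinctParts-unrestricted 1 (m ∸ 1)))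
                (gf-distinctParts-exactly m (k ∸ m) t) ⟩
    (shift eA GA ⊛ N) ⊛ shift eB GB   ≈⟨ ⊛-congʳ (shift eB GB) (⊛-shiftˡ eA GA N) ⟩
    shift eA (GA ⊛ N) ⊛ shift eB GB   ≈⟨ ⊛-shiftˡ eA (GA ⊛ N) (shift eB GB) ⟩
    shift eA ((GA ⊛ N) ⊛ shift eB GB) ≈⟨ shift-cong eA (⊛-shiftʳ eB (GA ⊛ N) GB) ⟩
    shift eA (shift eB ((GA ⊛ N) ⊛ GB)) ≈⟨ shift-shift eA eB ((GA ⊛ N) ⊛ GB) ⟩
    shift (eA ℕ.+ eB) ((GA ⊛ N) ⊛ GB) ∎
    where
    open ≗-Reasoning
    eA = a ℕ.* suc k ℕ.+ tri a
    eB = t ℕ.* m ℕ.+ tri t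
    GA = gaussPoly (n ℕ.+ a) a
    GB = gaussPoly (k ∸ m) t
    N  = negqPoch (m ∸ 1)

  length-candidatesWith : ∀ n t → t ≤ k ∸ m → + length (candidatesWith (largeCount t) t n) ≡ rhsTerm m k h t n
  length-candidatesWith n t t≤k∸m = count (largeCount t) refl
    where
    N = negqPoch (m ∸ 1)
    Gs = gauss (k ∸ m) t
    count : ∀ z → z ≡ largeCount t → + length (candidatesWith z t n) ≡ shiftZ (rhsExponent t) ((invQPoch z ⊛ N) ⊛ Gs) n
    count -[1+ _ ] _   =
      sym (shiftZ-vanishes (rhsExponent t) (λ i → trans (⊛-congʳ Gs (⊛-zeroˡ N) i) (⊛-zeroˡ Gs i)) n)
    count (+ a)    a≡L = begin
      + length (map glue (delay k (triples n a t) n))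
        ≡⟨ cong +_ (Listₚ.length-map glue (delay k (triples n a t) n)) ⟩
      gf (delay k (triples n a t)) n
        ≡⟨ gf-delay k (triples n a t) n ⟩
      shift k (gf (triples n a t)) n
        ≡⟨ trans (shift-cong k (gf-triples n a t) n) (shift-shift k _ _ n) ⟩
      shift E ((gaussPoly (n ℕ.+ a) a ⊛ N) ⊛ gaussPoly (k ∸ m) t) n
        ≡⟨ shift-≈[<] E (⊛-cong-≈[<] {g = gaussPoly (k ∸ m) t} (⊛-cong-≈[<] {g = N} G≈inv (λ _ → refl)) (λ _ → refl)) ⟩
      shift E ((inv (qPoch a) ⊛ N) ⊛ gaussPoly (k ∸ m) t) n
        ≡⟨ shift-cong E (⊛-congˡ (inv (qPoch a) ⊛ N) (gauss≗gaussPoly t≤k∸m)) n ⟨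
      shift E ((inv (qPoch a) ⊛ N) ⊛ Gs) n
        ≡⟨ shiftZ-+ E _ n ⟨
      shiftZ (+ E) ((inv (qPoch a) ⊛ N) ⊛ Gs) n
        ≡⟨ cong (λ e → shiftZ e ((inv (qPoch a) ⊛ N) ⊛ Gs) n) (exponent≡ a t a≡L) ⟨
      shiftZ (rhsExponent t) ((inv (qPoch a) ⊛ N) ⊛ Gs) n ∎
      where
      open ≡-Reasoning
      E = k ℕ.+ ((a ℕ.* suc k ℕ.+ tri a) ℕ.+ (t ℕ.* m ℕ.+ tri t))
      G≈inv : gaussPoly (n ℕ.+ a) a ≈[< suc n ] inv (qPoch a)
      G≈inv = gaussPoly≈[<]inv-qPoch n a

  length-candidates : ∀ n → + length (candidates n) ≡ rhs m k h n
  length-candidates n = trans (length-concatBelow (suc (k ∸ m)) _)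
    (Σ<-cong-< (suc (k ∸ m)) (λ { {t} (s≤s t≤k∸m) → length-candidatesWith n t t≤k∸m }))

  ∈-candidates⇔ : ∀ {n lam} → lam ∈ candidates n ⇔ Qualifies m k h n lam
  ∈-candidates⇔ = mk⇔ (decomposed⇒qualifies ∘′ ∈-candidates⁻) (∈-candidates⁺ ∘′ qualifies⇒decomposed)

theorem2p4 : (m k : ℕ) (h : ℤ) → 1 ≤ m → m ≤ k → (n : ℕ) →
    (L : List (List ℕ)) → Unique L → (∀ λ' → (λ' ∈ L) ⇔ Qualifies m k h n λ') →
    + length L ≡ rhs m k h n
theorem2p4 m k h 1≤m m≤k n L unique-L L⇔qualifies = begin
  + length L               ≡⟨ cong +_ (↭-length (∼bag⇒↭ (unique∧set⇒bag unique-L (candidates-unique n) L∼candidates))) ⟩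
  + length (candidates n)  ≡⟨ length-candidates n ⟩
  rhs m k h n              ∎
  where
  open ≡-Reasoning
  open FixedHook m k h 1≤m m≤k
  L∼candidates : L ∼[ set ] candidates n
  L∼candidates {lam} = ⇔-sym ∈-candidates⇔ ⇔-∘ L⇔qualifies lam
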